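{- Let $q=p^k$ with $p$ prime and $k\ge1$. Consider the dynamical systems $(\mathbb{F}_q, x\mapsto f(x))$ with $f(X)=aX^p+b$, where $a\in\mathbb{F}_q^*$ satisfies $\mathrm{Nm}_{\mathbb{F}_q/\mathbb{F}_p}(a)=1$ and $b\in\mathbb{F}_q$. Among these there are only two non-equivalent dynamical systems: two such systems are dynamically equivalent if and only if either both have a fixed point or neither has a fixed point. Moreover, if such an $f$ has a fixed point in $\mathbb{F}_q$, then it has precisely $p$ fixed points in $\mathbb{F}_q$.
   Context: Two dynamical systems $(\mathbb{S},f)$ and $(\mathbb{T},g)$ (maps $f:\mathbb{S}\to\mathbb{S}$, $g:\mathbb{T}\to\mathbb{T}$) are dynamically equivalent if there is a bijection $\sigma:\mathbb{S}\to\mathbb{T}$ with $\sigma^{ -1}\circ g\circ\sigma=f$. A fixed point of $f$ is $x$ with $f(x)=x$. The norm is $\mathrm{Nm}_{\mathbb{F}_q/\mathbb{F}_p}(x)=x^{1+p+\cdots+p^{k-1}}$. -}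

module Defs where

open import Level using (Level; _⊔_) renaming (suc to lsuc)
open import Data.Nat using (ℕ; zero; suc) renaming (_^_ to _^ℕ_; _+_ to _+ℕ_)
open import Data.Fin using (Fin)
open import Data.Product using (Σ; ∃; _×_; _,_; proj₁)
open import Relation.Nullary using (¬_)
open import Relation.Binary.Bundles using (Setoid)
open import Relation.Binary.PropositionalEquality as ≡ using (_≡_)
import Relation.Binary.Construct.On as On
open import Function.Bundles using (Inverse; Bijection)
open import Algebra.Bundles using (CommutativeRing; Semiring)

record FiniteField (c ℓ : Level) : Set (lsuc (c ⊔ ℓ)) where
  field
    commutativeRing : CommutativeRing c ℓ
  open CommutativeRing commutativeRing public
  field
    0≉1     : ¬ (0# ≈ 1#)
    inverse : ∀ x → ¬ (x ≈ 0#) → ∃ λ y → x * y ≈ 1#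
    size    : ℕ
    enum    : Bijection (≡.setoid (Fin size)) setoid
  open import Algebra.Definitions.RawSemiring (Semiring.rawSemiring semiring) public
    using (_^_)

DynEquiv : ∀ {a ℓ₁ b ℓ₂} (S : Setoid a ℓ₁) (T : Setoid b ℓ₂) →
           (Setoid.Carrier S → Setoid.Carrier S) →
           (Setoid.Carrier T → Setoid.Carrier T) → Set (a ⊔ ℓ₁ ⊔ b ⊔ ℓ₂)
DynEquiv S T f g =
  Σ (Inverse S T) λ σ →
    ∀ x → Setoid._≈_ S (Inverse.from σ (g (Inverse.to σ x))) (f x)

HasFixedPoint : ∀ {a ℓ} (S : Setoid a ℓ) → (Setoid.Carrier S → Setoid.Carrier S) → Set (a ⊔ ℓ)
HasFixedPoint S f = ∃ λ x → Setoid._≈_ S (f x) x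

FixedPoints : ∀ {a ℓ} (S : Setoid a ℓ) → (Setoid.Carrier S → Setoid.Carrier S) → Setoid (a ⊔ ℓ) ℓ
FixedPoints S f = On.setoid {B = Σ (Setoid.Carrier S) λ x → Setoid._≈_ S (f x) x} S proj₁

normExp : ℕ → ℕ → ℕ
normExp p zero    = zero
normExp p (suc k) = p ^ℕ k +ℕ normExp p k

module _ {c ℓ} (F : FiniteField c ℓ) where
  open FiniteField F

  Nm : ℕ → ℕ → Carrier → Carrier
  Nm p k x = x ^ normExp p k

  affineFrob : ℕ → Carrier → Carrier → Carrier → Carrier
  affineFrob p a b x = a * (x ^ p) + b

-- Write M(x) = a x^p for a with Nm(a) = 1, and f(x) = M(x) + b.  Because
-- x ↦ x^p is additive (the freshman's dream, once p · 1 = 0 is known), M is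
-- additive, and Hilbert 90 produces y₀ ≠ 0 with M(y₀) = y₀.  The affine change
-- of variables x ↦ y₀ x + x₀ then conjugates x ↦ x^p to f when x₀ is a fixed
-- point of f, and x ↦ y₀ x conjugates some normal form x ↦ x^p + β to f in
-- general.  The normal form x^p + β has a fixed point iff -β lies in the image
-- of the Artin–Schreier map ℘(x) = x^p - x.  Counting fibres of ℘ shows that
-- im ℘ is a proper subset of F and that, for γ′ ∉ im ℘, the translates
-- im ℘ + i γ′ (i ∈ 𝔽_p) cover F; the latter makes any two fixed-point-free
-- normal forms conjugate by some x ↦ i x + d.  The fixed points of f are
-- x₀ + i y₀ (i ∈ 𝔽_p), exactly p of them.
module Submission where

open import Level using (_⊔_)
open import Defs
open import Data.Nat as ℕ using (ℕ; zero; suc; _≤_; _<_; z≤n; s≤s; _∸_; _!; NonZero)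
import Data.Nat.Properties as ℕP
open import Data.Nat.Divisibility using (_∣_; divides; ∣⇒≤; n/m≡quotient)
open import Data.Nat.Coprimality using (prime⇒coprime; coprime-Bézout)
open import Data.Nat.GCD using (module Bézout)
open import Data.Nat.Primality using (Prime; euclidsLemma; prime⇒nonZero; prime⇒nonTrivial)
open import Data.Nat.Combinatorics using (_C_; nCn≡1; k![n∸k]!∣n!)
open import Data.Nat.Combinatorics.Specification using (nCk≡n!/k![n-k]!)
open import Data.Fin as Fin using (Fin; zero; suc; toℕ)
import Data.Fin.Properties as FinP
open import Data.Product using (Σ; ∃; _,_; proj₁; proj₂) renaming (_×_ to _∧_)
open import Data.Sum using (inj₁; inj₂)
open import Data.Empty using (⊥; ⊥-elim)
open import Relation.Nullary using (¬_; Dec; yes; no; ¬?; decidable-stable)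
open import Relation.Binary.PropositionalEquality as ≡ using (_≡_; _≢_)
open import Relation.Binary.Definitions using (tri<; tri≈; tri>)
open import Function.Bundles using (Bijection; Inverse; _⇔_; mk⇔; Equivalence)
import Function.Construct.Symmetry as Symmetry
import Function.Construct.Composition as Composition
open import Relation.Binary.Bundles using (Setoid)
import Algebra.Properties.Semiring.Sum as SemiringSum
import Algebra.Properties.CommutativeMonoid.Sum as CommutativeMonoidSum
open import Data.Fin.Permutation using (Permutation; permutation; _⟨$⟩ʳ_)
open import Algebra.Bundles using (CommutativeSemiring; CommutativeRing; RawRing)
open import Data.Integer as ℤ using (ℤ; +_; -[1+_]; _⊖_)
import Data.Integer.Properties as ℤP
open import Data.Sign as Sign using (Sign)
open import Data.Maybe using (Maybe; just; nothing)
open import Data.List using (List; []; _∷_; length)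
import Algebra.Solver.Ring.AlmostCommutativeRing as ACR

prime>1 : ∀ {p} → Prime p → 1 < p
prime>1 {p} pp = ℕ.nonTrivial⇒n>1 p {{prime⇒nonTrivial pp}}

prime∤factorial : ∀ {p} → Prime p → ∀ m → m < p → ¬ (p ∣ m !)
prime∤factorial pp zero    m<p p∣1 = ℕP.<⇒≱ (prime>1 pp) (∣⇒≤ p∣1)
prime∤factorial pp (suc m) m<p p∣[1+m]! with euclidsLemma (suc m) (m !) pp p∣[1+m]!
... | inj₁ p∣1+m = ℕP.<⇒≱ m<p (∣⇒≤ p∣1+m)
... | inj₂ p∣m!  = prime∤factorial pp m (ℕP.<-trans (ℕP.n<1+n m) m<p) p∣m!

n∣n! : ∀ n → 0 < n → n ∣ n !
n∣n! (suc n) _ = divides (n !) (ℕP.*-comm (suc n) (n !))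

-- The prime p divides the binomial coefficient (p C j) for 0 < j < p: it divides
-- p! = (p C j) · j! · (p - j)! but neither factorial.
prime∣binomial : ∀ {p j} → Prime p → 0 < j → j < p → p ∣ p C j
prime∣binomial {p} {j} pp 0<j j<p with k![n∸k]!∣n! {p} {j} (ℕP.<⇒≤ j<p)
... | divides t p!≡t*d = ≡.subst (p ∣_) (≡.sym pCj≡t) p∣t
  where
  instance _ = j ℕP.!* (p ∸ j) !≢0
  pCj≡t : p C j ≡ t
  pCj≡t = ≡.trans (nCk≡n!/k![n-k]! (ℕP.<⇒≤ j<p)) (n/m≡quotient (divides t p!≡t*d))
  p∣t : p ∣ t
  p∣t with euclidsLemma t (j ! ℕ.* (p ∸ j) !) pp (≡.subst (p ∣_) p!≡t*d (n∣n! p (ℕP.<-trans 0<j j<p)))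
  ... | inj₁ p∣t = p∣t
  ... | inj₂ p∣d with euclidsLemma (j !) ((p ∸ j) !) pp p∣d
  ...   | inj₁ p∣j!   = ⊥-elim (prime∤factorial pp j j<p p∣j!)
  ...   | inj₂ p∣p-j! = ⊥-elim (prime∤factorial pp (p ∸ j) (ℕP.∸-monoʳ-< {p} {j} {0} 0<j (ℕP.<⇒≤ j<p)) p∣p-j!)

-- The norm exponent satisfies N(j+1) = 1 + p · N(j); this is why the map
-- M(x) = a x^p has iterates M^j(x) = a^N(j) x^(p^j).
normExp-suc : ∀ p j → suc (normExp p j ℕ.* p) ≡ normExp p (suc j)
normExp-suc p zero    = ≡.refl
normExp-suc p (suc j) = begin
  suc ((p ℕ.^ j ℕ.+ normExp p j) ℕ.* p)         ≡⟨ ≡.cong suc (ℕP.*-distribʳ-+ p (p ℕ.^ j) (normExp p j)) ⟩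
  suc (p ℕ.^ j ℕ.* p ℕ.+ normExp p j ℕ.* p)     ≡⟨ ≡.sym (ℕP.+-suc (p ℕ.^ j ℕ.* p) (normExp p j ℕ.* p)) ⟩
  p ℕ.^ j ℕ.* p ℕ.+ suc (normExp p j ℕ.* p)     ≡⟨ ≡.cong₂ ℕ._+_ (ℕP.*-comm (p ℕ.^ j) p) (normExp-suc p j) ⟩
  p ℕ.* p ℕ.^ j ℕ.+ (p ℕ.^ j ℕ.+ normExp p j)   ∎
  where open ≡.≡-Reasoning

open SemiringSum ℕP.+-*-semiring using (∑-comm; *-distribˡ-sum) renaming (sum to ∑; sum-cong-≋ to ∑-cong)

∑-const : ∀ n c → ∑ {n} (λ _ → c) ≡ n ℕ.* c
∑-const zero    c = ≡.refl
∑-const (suc n) c = ≡.cong (c ℕ.+_) (∑-const n c)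

∑-mono : ∀ n {f g : Fin n → ℕ} → (∀ i → f i ≤ g i) → ∑ f ≤ ∑ g
∑-mono zero    f≤g = z≤n
∑-mono (suc n) f≤g = ℕP.+-mono-≤ (f≤g zero) (∑-mono n (λ i → f≤g (suc i)))

∑-saturated : ∀ n m (f : Fin n → ℕ) → (∀ i → f i ≤ m) → ∑ f ≡ n ℕ.* m → ∀ i → f i ≡ m
∑-saturated (suc n) m f f≤m ∑f≡ zero = ℕP.≤-antisym (f≤m zero) (ℕP.+-cancelʳ-≤ _ _ _ m+rest≤)
  where
  rest≤ : ∑ (λ i → f (suc i)) ≤ n ℕ.* m
  rest≤ = ℕP.≤-trans (∑-mono n (λ i → f≤m (suc i))) (ℕP.≤-reflexive (∑-const n m))
  m+rest≤ : m ℕ.+ n ℕ.* m ≤ f zero ℕ.+ n ℕ.* m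
  m+rest≤ = ℕP.≤-trans (ℕP.≤-reflexive (≡.sym ∑f≡)) (ℕP.+-monoʳ-≤ (f zero) rest≤)
∑-saturated (suc n) m f f≤m ∑f≡ (suc i) =
  ∑-saturated n m (λ j → f (suc j)) (λ j → f≤m (suc j)) rest≡ i
  where
  rest≡ : ∑ (λ j → f (suc j)) ≡ n ℕ.* m
  rest≡ = ℕP.+-cancelˡ-≡ m _ _
    (≡.trans (≡.cong (ℕ._+ ∑ (λ j → f (suc j))) (≡.sym (∑-saturated (suc n) m f f≤m ∑f≡ zero))) ∑f≡)

indicator : ∀ {a} {A : Set a} → Dec A → ℕ
indicator (yes _) = 1
indicator (no _)  = 0

count : ∀ {n a} {P : Fin n → Set a} → (∀ i → Dec (P i)) → ℕ
count P? = ∑ (λ i → indicator (P? i))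

count-none : ∀ {n a} {P : Fin n → Set a} (P? : ∀ i → Dec (P i)) → (∀ i → ¬ P i) → count P? ≡ 0
count-none {zero}  P? none = ≡.refl
count-none {suc n} P? none with P? zero
... | yes P0 = ⊥-elim (none zero P0)
... | no _   = count-none (λ i → P? (suc i)) (λ i → none (suc i))

count-unique : ∀ {n a} {P : Fin n → Set a} (P? : ∀ i → Dec (P i)) →
               (∀ i j → P i → P j → i ≡ j) → ∀ i → P i → count P? ≡ 1
count-unique {suc n} P? uniq zero P0 with P? zero
... | yes _   = ≡.cong suc (count-none (λ i → P? (suc i)) (λ i Pi → FinP.0≢1+n (uniq zero (suc i) P0 Pi)))
... | no ¬P0 = ⊥-elim (¬P0 P0)
count-unique {suc n} P? uniq (suc i) Pi with P? zero
... | yes P0 = ⊥-elim (FinP.0≢1+n (uniq zero (suc i) P0 Pi))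
... | no _   = count-unique (λ j → P? (suc j)) (λ j l Pj Pl → FinP.suc-injective (uniq (suc j) (suc l) Pj Pl)) i Pi

count-≤1 : ∀ {n a} {P : Fin n → Set a} (P? : ∀ i → Dec (P i)) →
           (∀ i j → P i → P j → i ≡ j) → count P? ≤ 1
count-≤1 P? uniq with FinP.any? P?
... | yes (i , Pi) = ℕP.≤-reflexive (count-unique P? uniq i Pi)
... | no none      = ≡.subst (_≤ 1) (≡.sym (count-none P? (λ i Pi → none (i , Pi)))) z≤n

count-pos : ∀ {n a} {P : Fin n → Set a} (P? : ∀ i → Dec (P i)) → 0 < count P? → ∃ P
count-pos P? pos with FinP.any? P?
... | yes found = found
... | no none   = ⊥-elim (ℕP.<⇒≢ pos (≡.sym (count-none P? (λ i Pi → none (i , Pi)))))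

module IntegerRingSolver {c ℓ} (R : CommutativeRing c ℓ) where
  open CommutativeRing R
  open import Relation.Binary.Reasoning.Setoid setoid
  open import Algebra.Properties.Ring ring using (-0#≈0#; -‿involutive; -‿+-comm; -‿distribˡ-*; -‿distribʳ-*)
  open import Algebra.Properties.Semiring.Mult semiring using (_×_; ×-homo-+; ×1-homo-*)

  ⟦_⟧ : ℤ → Carrier
  ⟦ + n ⟧    = n × 1#
  ⟦ -[1+ n ] ⟧ = - (suc n × 1#)

  -- ℤ-multiplication works on signs and absolute values separately
  signed : Sign → Carrier → Carrier
  signed Sign.+ x = x
  signed Sign.- x = - x

  signed-cong : ∀ s {x y} → x ≈ y → signed s x ≈ signed s y
  signed-cong Sign.+ x≈y = x≈y
  signed-cong Sign.- x≈y = -‿cong x≈y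

  signed-* : ∀ s t x y → signed (s Sign.* t) (x * y) ≈ signed s x * signed t y
  signed-* Sign.+ Sign.+ x y = refl
  signed-* Sign.+ Sign.- x y = -‿distribʳ-* x y
  signed-* Sign.- Sign.+ x y = -‿distribˡ-* x y
  signed-* Sign.- Sign.- x y = begin
    x * y           ≈⟨ -‿involutive (x * y) ⟨
    - - (x * y)     ≈⟨ -‿cong (-‿distribʳ-* x y) ⟩
    - (x * - y)     ≈⟨ -‿distribˡ-* x (- y) ⟩
    - x * - y       ∎

  ⟦⟧-signed : ∀ i → ⟦ i ⟧ ≈ signed (ℤ.sign i) (ℤ.∣ i ∣ × 1#)
  ⟦⟧-signed (+ _)    = refl
  ⟦⟧-signed -[1+ _ ] = refl

  ⟦◃⟧ : ∀ s n → ⟦ s ℤ.◃ n ⟧ ≈ signed s (n × 1#)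
  ⟦◃⟧ Sign.+ zero    = refl
  ⟦◃⟧ Sign.- zero    = sym -0#≈0#
  ⟦◃⟧ Sign.+ (suc n) = refl
  ⟦◃⟧ Sign.- (suc n) = refl

  ⟦⊖⟧ : ∀ m n → ⟦ m ⊖ n ⟧ ≈ m × 1# - n × 1#
  ⟦⊖⟧ m zero rewrite ℤP.⊖-≥ {m} {0} z≤n = sym (trans (+-congˡ -0#≈0#) (+-identityʳ _))
  ⟦⊖⟧ zero (suc n) rewrite ℤP.⊖-< {0} {suc n} (s≤s z≤n) = sym (+-identityˡ _)
  ⟦⊖⟧ (suc m) (suc n) rewrite ℤP.[1+m]⊖[1+n]≡m⊖n m n = begin
    ⟦ m ⊖ n ⟧                          ≈⟨ ⟦⊖⟧ m n ⟩
    m × 1# - n × 1#                    ≈⟨ shift (m × 1#) (n × 1#) ⟩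
    (1# + m × 1#) - (1# + n × 1#)      ∎
    where
    shift : ∀ a b → a - b ≈ (1# + a) - (1# + b)
    shift a b = begin
      a - b                        ≈⟨ +-identityˡ _ ⟨
      0# + (a - b)                 ≈⟨ +-congʳ (-‿inverseʳ 1#) ⟨
      (1# - 1#) + (a - b)          ≈⟨ +-congʳ (+-comm 1# (- 1#)) ⟩
      (- 1# + 1#) + (a - b)        ≈⟨ +-assoc (- 1#) 1# (a - b) ⟩
      - 1# + (1# + (a - b))        ≈⟨ +-congˡ (+-assoc 1# a (- b)) ⟨
      - 1# + ((1# + a) - b)        ≈⟨ +-comm (- 1#) _ ⟩
      ((1# + a) - b) + - 1#        ≈⟨ +-assoc (1# + a) (- b) (- 1#) ⟩
      (1# + a) + (- b + - 1#)      ≈⟨ +-congˡ (-‿+-comm b 1#) ⟩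
      (1# + a) - (b + 1#)          ≈⟨ +-congˡ (-‿cong (+-comm b 1#)) ⟩
      (1# + a) - (1# + b)          ∎

  ⟦+⟧ : ∀ i j → ⟦ i ℤ.+ j ⟧ ≈ ⟦ i ⟧ + ⟦ j ⟧
  ⟦+⟧ -[1+ m ] -[1+ n ] = begin
    - (suc (suc (m ℕ.+ n)) × 1#)          ≈⟨ -‿cong (reflexive (≡.cong (λ t → suc t × 1#) (≡.sym (ℕP.+-suc m n)))) ⟩
    - ((suc m ℕ.+ suc n) × 1#)            ≈⟨ -‿cong (×-homo-+ 1# (suc m) (suc n)) ⟩
    - (suc m × 1# + suc n × 1#)           ≈⟨ -‿+-comm _ _ ⟨
    - (suc m × 1#) + - (suc n × 1#)       ∎
  ⟦+⟧ -[1+ m ] (+ n)    = trans (⟦⊖⟧ n (suc m)) (+-comm _ _)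
  ⟦+⟧ (+ m)    -[1+ n ] = ⟦⊖⟧ m (suc n)
  ⟦+⟧ (+ m)    (+ n)    = ×-homo-+ 1# m n

  ⟦*⟧ : ∀ i j → ⟦ i ℤ.* j ⟧ ≈ ⟦ i ⟧ * ⟦ j ⟧
  ⟦*⟧ i j = begin
    ⟦ i ℤ.* j ⟧                                     ≈⟨ ⟦◃⟧ (s Sign.* t) (ℤ.∣ i ∣ ℕ.* ℤ.∣ j ∣) ⟩
    signed (s Sign.* t) ((ℤ.∣ i ∣ ℕ.* ℤ.∣ j ∣) × 1#)  ≈⟨ signed-cong (s Sign.* t) (×1-homo-* ℤ.∣ i ∣ ℤ.∣ j ∣) ⟩
    signed (s Sign.* t) (ℤ.∣ i ∣ × 1# * ℤ.∣ j ∣ × 1#) ≈⟨ signed-* s t _ _ ⟩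
    signed s (ℤ.∣ i ∣ × 1#) * signed t (ℤ.∣ j ∣ × 1#) ≈⟨ *-cong (⟦⟧-signed i) (⟦⟧-signed j) ⟨
    ⟦ i ⟧ * ⟦ j ⟧                                   ∎
    where
    s = ℤ.sign i
    t = ℤ.sign j

  ⟦-⟧ : ∀ i → ⟦ ℤ.- i ⟧ ≈ - ⟦ i ⟧
  ⟦-⟧ (+ zero)  = sym -0#≈0#
  ⟦-⟧ (+ suc n) = refl
  ⟦-⟧ -[1+ n ]  = sym (-‿involutive _)

  private
    ℤ-rawRing : RawRing _ _
    ℤ-rawRing = record
      { Carrier = ℤ ; _≈_ = _≡_ ; _+_ = ℤ._+_ ; _*_ = ℤ._*_ ; -_ = ℤ.-_ ; 0# = + 0 ; 1# = + 1 }

    ring′ : ACR.AlmostCommutativeRing c ℓ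
    ring′ = ACR.fromCommutativeRing R

    homomorphism : ℤ-rawRing ACR.-Raw-AlmostCommutative⟶ ring′
    homomorphism = record
      { ⟦_⟧ = ⟦_⟧ ; +-homo = ⟦+⟧ ; *-homo = ⟦*⟧ ; -‿homo = ⟦-⟧ ; 0-homo = refl ; 1-homo = +-identityʳ 1# }

    ⟦⟧-equal? : ∀ i j → Maybe (⟦ i ⟧ ≈ ⟦ j ⟧)
    ⟦⟧-equal? i j with i ℤP.≟ j
    ... | yes ≡.refl = just refl
    ... | no _       = nothing

  open import Algebra.Solver.Ring ℤ-rawRing ring′ homomorphism ⟦⟧-equal? public
    using (solve; _:=_; _:+_; _:*_; _:-_; :-_; con)

module FieldBasics {c ℓ} (F : FiniteField c ℓ) where
  open FiniteField F public hiding (zero)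
  open import Relation.Binary.Reasoning.Setoid setoid
  open import Algebra.Properties.Ring ring public
  open import Algebra.Properties.Semiring.Mult semiring public
  open import Algebra.Properties.Semiring.Exp semiring public hiding (_^_)
  open import Algebra.Properties.CommutativeSemiring.Exp commutativeSemiring public using (^-distrib-*)
  open IntegerRingSolver commutativeRing public using (solve; _:=_; _:+_; _:*_; _:-_; :-_; con)

  ι : ℕ → Carrier
  ι n = n × 1#

  q : ℕ
  q = size

  elem : Fin q → Carrier
  elem = Bijection.to enum

  elem-injective : ∀ {i j} → elem i ≈ elem j → i ≡ j
  elem-injective = Bijection.injective enum

  index : Carrier → Fin q
  index x = proj₁ (Bijection.surjective enum x)

  elem-index : ∀ x → elem (index x) ≈ x
  elem-index x = proj₂ (Bijection.surjective enum x) ≡.refl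

  infix 4 _≟_
  _≟_ : ∀ x y → Dec (x ≈ y)
  x ≟ y with index x FinP.≟ index y
  ... | yes i≡j = yes (trans (sym (elem-index x)) (trans (reflexive (≡.cong elem i≡j)) (elem-index y)))
  ... | no  i≢j = no λ x≈y → i≢j (elem-injective (trans (elem-index x) (trans x≈y (sym (elem-index y)))))

  exists? : ∀ {a} (P : Carrier → Set a) → (∀ {x y} → x ≈ y → P x → P y) → (∀ x → Dec (P x)) → Dec (∃ P)
  exists? P resp P? with FinP.any? (λ i → P? (elem i))
  ... | yes (i , Pi) = yes (elem i , Pi)
  ... | no  none     = no λ (x , Px) → none (index x , resp (sym (elem-index x)) Px)

  -- F is nonempty (it contains 0)
  size-suc : ∃ λ n → q ≡ suc n
  size-suc with q | index 0#
  ... | suc n | _ = n , ≡.refl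

  count-one-solution : ∀ {a} {P : Carrier → Set a} (P? : ∀ x → Dec (P x)) → (∀ {x y} → x ≈ y → P x → P y) →
                       (∀ {x y} → P x → P y → x ≈ y) → ∀ {x} → P x → count (λ i → P? (elem i)) ≡ 1
  count-one-solution P? resp unique {x} Px =
    count-unique (λ i → P? (elem i)) (λ i j Pi Pj → elem-injective (unique Pi Pj)) (index x) (resp (sym (elem-index x)) Px)

  1≉0 : ¬ (1# ≈ 0#)
  1≉0 1≈0 = 0≉1 (sym 1≈0)

  _⁻¹⟨_⟩ : ∀ x → ¬ (x ≈ 0#) → Carrier
  x ⁻¹⟨ x≉0 ⟩ = proj₁ (inverse x x≉0)

  inverseʳ : ∀ x (x≉0 : ¬ (x ≈ 0#)) → x * x ⁻¹⟨ x≉0 ⟩ ≈ 1#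
  inverseʳ x x≉0 = proj₂ (inverse x x≉0)

  inverseˡ : ∀ x (x≉0 : ¬ (x ≈ 0#)) → x ⁻¹⟨ x≉0 ⟩ * x ≈ 1#
  inverseˡ x x≉0 = trans (*-comm _ _) (inverseʳ x x≉0)

  cancel-inverseˡ : ∀ x (x≉0 : ¬ (x ≈ 0#)) y → x ⁻¹⟨ x≉0 ⟩ * (x * y) ≈ y
  cancel-inverseˡ x x≉0 y = trans (sym (*-assoc _ x y)) (trans (*-congʳ (inverseˡ x x≉0)) (*-identityˡ y))

  cancel-inverseʳ : ∀ x (x≉0 : ¬ (x ≈ 0#)) y → x * (x ⁻¹⟨ x≉0 ⟩ * y) ≈ y
  cancel-inverseʳ x x≉0 y = trans (sym (*-assoc x _ y)) (trans (*-congʳ (inverseʳ x x≉0)) (*-identityˡ y))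

  *-cancelˡ : ∀ x {y z} → ¬ (x ≈ 0#) → x * y ≈ x * z → y ≈ z
  *-cancelˡ x {y} {z} x≉0 xy≈xz = begin
    y                       ≈⟨ cancel-inverseˡ x x≉0 y ⟨
    x ⁻¹⟨ x≉0 ⟩ * (x * y)   ≈⟨ *-congˡ xy≈xz ⟩
    x ⁻¹⟨ x≉0 ⟩ * (x * z)   ≈⟨ cancel-inverseˡ x x≉0 z ⟩
    z                       ∎

  zero-divisor : ∀ {x y} → x * y ≈ 0# → ¬ (x ≈ 0#) → y ≈ 0#
  zero-divisor {x} {y} xy≈0 x≉0 = *-cancelˡ x x≉0 (trans xy≈0 (sym (zeroʳ x)))

  *-nonzero : ∀ {x y} → ¬ (x ≈ 0#) → ¬ (y ≈ 0#) → ¬ (x * y ≈ 0#)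
  *-nonzero x≉0 y≉0 xy≈0 = y≉0 (zero-divisor xy≈0 x≉0)

  ^-nonzero : ∀ {x} n → ¬ (x ≈ 0#) → ¬ (x ^ n ≈ 0#)
  ^-nonzero zero    x≉0 = 1≉0
  ^-nonzero (suc n) x≉0 = *-nonzero x≉0 (^-nonzero n x≉0)

  ^≈0⇒≈0 : ∀ {x} n → x ^ n ≈ 0# → x ≈ 0#
  ^≈0⇒≈0 {x} n xⁿ≈0 with x ≟ 0#
  ... | yes x≈0 = x≈0
  ... | no  x≉0 = ⊥-elim (^-nonzero n x≉0 xⁿ≈0)

  1^ : ∀ n → 1# ^ n ≈ 1#
  1^ zero    = refl
  1^ (suc n) = trans (*-identityˡ _) (1^ n)

  0^ : ∀ n → .{{NonZero n}} → 0# ^ n ≈ 0#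
  0^ (suc n) = zeroˡ _

-- Sums and products over all elements of F: q · 1 = 0, and Fermat's little
-- theorem x ^ q = x.  Both compare a sum (product) over F with the same sum
-- (product) reindexed along a bijection of F.
module FermatsLittleTheorem {c ℓ} (F : FiniteField c ℓ) where
  open FieldBasics F
  open import Relation.Binary.Reasoning.Setoid setoid
  module Σ+ = CommutativeMonoidSum +-commutativeMonoid
  module Π* = CommutativeMonoidSum *-commutativeMonoid

  reindexing : (h h⁻¹ : Carrier → Carrier) → (∀ {x y} → x ≈ y → h x ≈ h y) → (∀ {x y} → x ≈ y → h⁻¹ x ≈ h⁻¹ y) →
               (∀ x → h (h⁻¹ x) ≈ x) → (∀ x → h⁻¹ (h x) ≈ x) → Permutation q q
  reindexing h h⁻¹ h-cong h⁻¹-cong hh⁻¹ h⁻¹h = permutation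
    (λ i → index (h (elem i))) (λ i → index (h⁻¹ (elem i)))
    (λ i → elem-injective (trans (elem-index _) (trans (h-cong (elem-index _)) (hh⁻¹ (elem i)))))
    (λ i → elem-injective (trans (elem-index _) (trans (h⁻¹-cong (elem-index _)) (h⁻¹h (elem i)))))

  -- translation by 1 permutes F, so ∑ x = ∑ (x + 1) = ∑ x + q · 1
  size·1≈0 : q × 1# ≈ 0#
  size·1≈0 = begin
    q × 1#                       ≈⟨ solve 2 (λ t s → t := (s :+ t) :- s) refl (q × 1#) S ⟩
    (S + q × 1#) - S             ≈⟨ +-congʳ shifted ⟩
    S - S                        ≈⟨ -‿inverseʳ S ⟩
    0#                           ∎
    where
    S = Σ+.sum elem
    +1 = reindexing (_+ 1#) (_- 1#) +-congʳ +-congʳ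
           (λ x → solve 2 (λ x o → (x :- o) :+ o := x) refl x 1#)
           (λ x → solve 2 (λ x o → (x :+ o) :- o := x) refl x 1#)
    shifted : S + q × 1# ≈ S
    shifted = begin
      S + q × 1#                         ≈⟨ +-congˡ (Σ+.sum-replicate q) ⟨
      S + Σ+.sum {q} (λ _ → 1#)          ≈⟨ Σ+.∑-distrib-+ elem (λ _ → 1#) ⟨
      Σ+.sum (λ i → elem i + 1#)         ≈⟨ Σ+.sum-cong-≋ (λ i → sym (elem-index (elem i + 1#))) ⟩
      Σ+.sum (λ i → elem (+1 ⟨$⟩ʳ i))    ≈⟨ Σ+.sum-permute elem +1 ⟨
      S                                  ∎

  ∏ : ∀ {n} → (Fin n → Carrier) → Carrier
  ∏ = Π*.sum

  ∏-nonzero : ∀ n (f : Fin n → Carrier) → (∀ i → ¬ (f i ≈ 0#)) → ¬ (∏ f ≈ 0#)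
  ∏-nonzero zero    f f≉0 = 1≉0
  ∏-nonzero (suc n) f f≉0 = *-nonzero (f≉0 zero) (∏-nonzero n (λ i → f (suc i)) (λ i → f≉0 (suc i)))

  ∏-scale : ∀ n a (f : Fin n → Carrier) → ∏ (λ i → a * f i) ≈ a ^ n * ∏ f
  ∏-scale zero    a f = sym (*-identityˡ 1#)
  ∏-scale (suc n) a f = begin
    (a * f zero) * ∏ (λ i → a * f (suc i))           ≈⟨ *-congˡ (∏-scale n a (λ i → f (suc i))) ⟩
    (a * f zero) * (a ^ n * ∏ (λ i → f (suc i)))     ≈⟨ solve 4 (λ a b c d → (a :* b) :* (c :* d) := (a :* c) :* (b :* d)) refl a (f zero) (a ^ n) _ ⟩
    (a * a ^ n) * (f zero * ∏ (λ i → f (suc i)))     ∎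

  ∏-differ-at : ∀ n (f g : Fin n → Carrier) i₀ → (∀ i → i ≢ i₀ → f i ≈ g i) → f i₀ * ∏ g ≈ g i₀ * ∏ f
  ∏-differ-at (suc n) f g zero f≈g = begin
    f zero * (g zero * ∏ (λ i → g (suc i)))   ≈⟨ *-congˡ (*-congˡ (Π*.sum-cong-≋ (λ i → sym (f≈g (suc i) λ ())))) ⟩
    f zero * (g zero * ∏ (λ i → f (suc i)))   ≈⟨ swap (f zero) (g zero) _ ⟩
    g zero * (f zero * ∏ (λ i → f (suc i)))   ∎
    where swap = λ a b c → solve 3 (λ a b c → a :* (b :* c) := b :* (a :* c)) refl a b c
  ∏-differ-at (suc n) f g (suc j) f≈g = begin
    f (suc j) * (g zero * ∏ (λ i → g (suc i)))   ≈⟨ swap (f (suc j)) (g zero) _ ⟩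
    g zero * (f (suc j) * ∏ (λ i → g (suc i)))   ≈⟨ *-cong (sym (f≈g zero λ ())) (∏-differ-at n (λ i → f (suc i)) (λ i → g (suc i)) j
                                                      (λ i i≢j → f≈g (suc i) (λ eq → i≢j (FinP.suc-injective eq)))) ⟩
    f zero * (g (suc j) * ∏ (λ i → f (suc i)))   ≈⟨ swap (f zero) (g (suc j)) _ ⟩
    g (suc j) * (f zero * ∏ (λ i → f (suc i)))   ∎
    where swap = λ a b c → solve 3 (λ a b c → a :* (b :* c) := b :* (a :* c)) refl a b c

  -- x with 0 replaced by 1, so that a product of such values is a unit
  unzero : Carrier → Carrier
  unzero x with x ≟ 0#
  ... | yes _ = 1#
  ... | no  _ = x

  unzero-nonzero : ∀ x → ¬ (unzero x ≈ 0#)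
  unzero-nonzero x with x ≟ 0#
  ... | yes _   = 1≉0
  ... | no  x≉0 = x≉0

  unzero-zero : ∀ {x} → x ≈ 0# → unzero x ≈ 1#
  unzero-zero {x} x≈0 with x ≟ 0#
  ... | yes _   = refl
  ... | no  x≉0 = ⊥-elim (x≉0 x≈0)

  unzero-id : ∀ {x} → ¬ (x ≈ 0#) → unzero x ≈ x
  unzero-id {x} x≉0 with x ≟ 0#
  ... | yes x≈0 = ⊥-elim (x≉0 x≈0)
  ... | no  _   = refl

  unzero-cong : ∀ {x y} → x ≈ y → unzero x ≈ unzero y
  unzero-cong {x} {y} x≈y with x ≟ 0# | y ≟ 0#
  ... | yes _   | yes _   = refl
  ... | yes x≈0 | no  y≉0 = ⊥-elim (y≉0 (trans (sym x≈y) x≈0))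
  ... | no  x≉0 | yes y≈0 = ⊥-elim (x≉0 (trans x≈y y≈0))
  ... | no  _   | no  _   = x≈y

  -- For a ≠ 0, multiplication by a permutes F; comparing ∏ unzero (a x)
  -- with ∏ a · unzero x (which differ only at x = 0) gives a P = a^q P.
  fermat-nonzero : ∀ a → ¬ (a ≈ 0#) → a ^ q ≈ a
  fermat-nonzero a a≉0 = *-cancelˡ P (∏-nonzero q (λ i → unzero (elem i)) (λ i → unzero-nonzero (elem i))) (begin
    P * a ^ q         ≈⟨ *-comm _ _ ⟩
    a ^ q * P         ≈⟨ ∏-scale q a (λ i → unzero (elem i)) ⟨
    ∏ g               ≈⟨ *-identityˡ _ ⟨
    1# * ∏ g          ≈⟨ *-congʳ (unzero-zero (trans (*-congˡ (elem-index 0#)) (zeroʳ a))) ⟨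
    f i₀ * ∏ g        ≈⟨ ∏-differ-at q f g i₀ f≈g ⟩
    g i₀ * ∏ f        ≈⟨ *-cong (trans (*-congˡ (unzero-zero (elem-index 0#))) (*-identityʳ a)) ∏f≈P ⟩
    a * P             ≈⟨ *-comm _ _ ⟩
    P * a             ∎)
    where
    P = ∏ (λ i → unzero (elem i))
    f g : Fin q → Carrier
    f i = unzero (a * elem i)
    g i = a * unzero (elem i)
    i₀ = index 0#
    a· = reindexing (a *_) (a ⁻¹⟨ a≉0 ⟩ *_) *-congˡ *-congˡ (cancel-inverseʳ a a≉0) (cancel-inverseˡ a a≉0)
    ∏f≈P : ∏ f ≈ P
    ∏f≈P = begin
      ∏ f                                    ≈⟨ Π*.sum-cong-≋ (λ i → unzero-cong (sym (elem-index (a * elem i)))) ⟩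
      ∏ (λ i → unzero (elem (a· ⟨$⟩ʳ i)))     ≈⟨ Π*.sum-permute (λ i → unzero (elem i)) a· ⟨
      P                                      ∎
    f≈g : ∀ i → i ≢ i₀ → f i ≈ g i
    f≈g i i≢i₀ = trans (unzero-id (*-nonzero a≉0 xᵢ≉0)) (*-congˡ (sym (unzero-id xᵢ≉0)))
      where
      xᵢ≉0 : ¬ (elem i ≈ 0#)
      xᵢ≉0 xᵢ≈0 = i≢i₀ (elem-injective (trans xᵢ≈0 (sym (elem-index 0#))))

  fermat : ∀ a → a ^ q ≈ a
  fermat a with a ≟ 0# | size-suc
  ... | no  a≉0 | _           = fermat-nonzero a a≉0
  ... | yes a≈0 | n , q≡1+n = begin
    a ^ q         ≈⟨ ^-cong a≈0 q≡1+n ⟩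
    0# ^ suc n    ≈⟨ zeroˡ _ ⟩
    0#            ≈⟨ a≈0 ⟨
    a             ∎

-- Polynomials over F as coefficient lists (constant term first), and the
-- root bound: a polynomial with fewer coefficients than it has distinct
-- roots is the zero polynomial.
module PolynomialRoots {c ℓ} (F : FiniteField c ℓ) where
  open FieldBasics F
  open import Relation.Binary.Reasoning.Setoid setoid

  Poly : Set c
  Poly = List Carrier

  eval : Poly → Carrier → Carrier
  eval []       z = 0#
  eval (c ∷ cs) z = c + z * eval cs z

  coeff : Poly → ℕ → Carrier
  coeff []       m       = 0#
  coeff (c ∷ cs) zero    = c
  coeff (c ∷ cs) (suc m) = coeff cs m

  IsZero : Poly → Set ℓ
  IsZero cs = ∀ m → coeff cs m ≈ 0#

  -- synthetic division by X - r: the quotient, with cs = (X - r) · quotient + cs(r)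
  quotient : Carrier → Poly → Poly
  quotient r []             = []
  quotient r (c ∷ [])       = []
  quotient r (c ∷ c′ ∷ cs)  = eval (c′ ∷ cs) r ∷ quotient r (c′ ∷ cs)

  division : ∀ r cs z → eval cs z ≈ (z - r) * eval (quotient r cs) z + eval cs r
  division r []       z = solve 2 (λ z r → con (+ 0) := (z :- r) :* con (+ 0) :+ con (+ 0)) refl z r
  division r (c ∷ []) z =
    solve 3 (λ c z r → c :+ z :* con (+ 0) := (z :- r) :* con (+ 0) :+ (c :+ r :* con (+ 0))) refl c z r
  division r (c ∷ c′ ∷ cs) z = begin
    c + z * E                     ≈⟨ +-congˡ (*-congˡ (division r (c′ ∷ cs) z)) ⟩
    c + z * ((z - r) * Q + E[r])  ≈⟨ solve 5 (λ c z r Q m → c :+ z :* ((z :- r) :* Q :+ m) := (z :- r) :* (m :+ z :* Q) :+ (c :+ r :* m)) refl c z r Q E[r] ⟩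
    (z - r) * (E[r] + z * Q) + (c + r * E[r]) ∎
    where
    E    = eval (c′ ∷ cs) z
    Q    = eval (quotient r (c′ ∷ cs)) z
    E[r] = eval (c′ ∷ cs) r

  quotient-zero : ∀ r cs → IsZero (quotient r cs) → eval cs r ≈ 0# → IsZero cs
  quotient-zero r []       _  _    m = refl
  quotient-zero r (c ∷ []) _  cs[r]≈0 zero = trans (sym (trans (+-congˡ (zeroʳ r)) (+-identityʳ c))) cs[r]≈0
  quotient-zero r (c ∷ []) _  _    (suc m) = refl
  quotient-zero r (c ∷ c′ ∷ cs) Q≈0 cs[r]≈0 zero =
    trans (sym (trans (+-congˡ (trans (*-congˡ (Q≈0 zero)) (zeroʳ r))) (+-identityʳ c))) cs[r]≈0
  quotient-zero r (c ∷ c′ ∷ cs) Q≈0 _ (suc m) = quotient-zero r (c′ ∷ cs) (λ m → Q≈0 (suc m)) (Q≈0 zero) m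

  length-quotient : ∀ r cs → length (quotient r cs) ≡ ℕ.pred (length cs)
  length-quotient r []            = ≡.refl
  length-quotient r (c ∷ [])      = ≡.refl
  length-quotient r (c ∷ c′ ∷ cs) = ≡.cong suc (length-quotient r (c′ ∷ cs))

  root-bound : ∀ n (v : Fin n → Carrier) → (∀ {i j} → v i ≈ v j → i ≡ j) →
               ∀ cs → length cs ≤ n → (∀ i → eval cs (v i) ≈ 0#) → IsZero cs
  root-bound zero    v v-inj [] _ _ m = refl
  root-bound (suc n) v v-inj cs len≤ roots = quotient-zero r cs Q≈0 (roots zero)
    where
    r = v zero
    -- every other root of cs is a root of the quotient, since z - r ≠ 0
    Q-roots : ∀ i → eval (quotient r cs) (v (suc i)) ≈ 0#
    Q-roots i = zero-divisor product≈0 z-r≉0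
      where
      z = v (suc i)
      product≈0 : (z - r) * eval (quotient r cs) z ≈ 0#
      product≈0 = begin
        (z - r) * eval (quotient r cs) z                        ≈⟨ solve 2 (λ a b → a := a :+ b :- b) refl _ (eval cs r) ⟩
        ((z - r) * eval (quotient r cs) z + eval cs r) - eval cs r  ≈⟨ +-congʳ (division r cs z) ⟨
        eval cs z - eval cs r                                   ≈⟨ +-cong (roots (suc i)) (-‿cong (roots zero)) ⟩
        0# - 0#                                                 ≈⟨ -‿inverseʳ 0# ⟩
        0#                                                      ∎
      z-r≉0 : ¬ (z - r ≈ 0#)
      z-r≉0 z-r≈0 with v-inj {suc i} {zero} (trans (solve 2 (λ a b → a := (a :- b) :+ b) refl z r)
                                                  (trans (+-congʳ z-r≈0) (+-identityˡ r)))
      ... | ()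
    Q≈0 : IsZero (quotient r cs)
    Q≈0 = root-bound n (λ i → v (suc i)) (λ eq → FinP.suc-injective (v-inj eq)) (quotient r cs)
            (≡.subst (_≤ n) (≡.sym (length-quotient r cs)) (ℕP.pred-mono-≤ len≤)) Q-roots

  add : Poly → Poly → Poly
  add []       ys       = ys
  add (x ∷ xs) []       = x ∷ xs
  add (x ∷ xs) (y ∷ ys) = x + y ∷ add xs ys

  eval-add : ∀ xs ys z → eval (add xs ys) z ≈ eval xs z + eval ys z
  eval-add []       ys       z = sym (+-identityˡ _)
  eval-add (x ∷ xs) []       z = sym (+-identityʳ _)
  eval-add (x ∷ xs) (y ∷ ys) z = begin
    (x + y) + z * eval (add xs ys) z            ≈⟨ +-congˡ (*-congˡ (eval-add xs ys z)) ⟩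
    (x + y) + z * (eval xs z + eval ys z)       ≈⟨ solve 5 (λ x y z a b → (x :+ y) :+ z :* (a :+ b) := (x :+ z :* a) :+ (y :+ z :* b)) refl x y z _ _ ⟩
    (x + z * eval xs z) + (y + z * eval ys z)   ∎

  coeff-add : ∀ xs ys m → coeff (add xs ys) m ≈ coeff xs m + coeff ys m
  coeff-add []       ys       m       = sym (+-identityˡ _)
  coeff-add (x ∷ xs) []       zero    = sym (+-identityʳ _)
  coeff-add (x ∷ xs) []       (suc m) = sym (+-identityʳ _)
  coeff-add (x ∷ xs) (y ∷ ys) zero    = refl
  coeff-add (x ∷ xs) (y ∷ ys) (suc m) = coeff-add xs ys m

  length-add : ∀ xs ys n → length xs ≤ n → length ys ≤ n → length (add xs ys) ≤ n
  length-add []       ys       n       _         ys≤ = ys≤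
  length-add (x ∷ xs) []       n       xs≤       _   = xs≤
  length-add (x ∷ xs) (y ∷ ys) (suc n) (s≤s xs≤) (s≤s ys≤) = s≤s (length-add xs ys n xs≤ ys≤)

  monomial : Carrier → ℕ → Poly
  monomial c zero    = c ∷ []
  monomial c (suc n) = 0# ∷ monomial c n

  eval-monomial : ∀ c n z → eval (monomial c n) z ≈ c * z ^ n
  eval-monomial c zero    z = trans (+-congˡ (zeroʳ z)) (trans (+-identityʳ c) (sym (*-identityʳ c)))
  eval-monomial c (suc n) z = begin
    0# + z * eval (monomial c n) z   ≈⟨ +-congˡ (*-congˡ (eval-monomial c n z)) ⟩
    0# + z * (c * z ^ n)             ≈⟨ solve 3 (λ z c w → con (+ 0) :+ z :* (c :* w) := c :* (z :* w)) refl z c (z ^ n) ⟩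
    c * (z * z ^ n)                  ∎

  coeff-monomial : ∀ c n → coeff (monomial c n) n ≡ c
  coeff-monomial c zero    = ≡.refl
  coeff-monomial c (suc n) = coeff-monomial c n

  length-monomial : ∀ c n → length (monomial c n) ≡ suc n
  length-monomial c zero    = ≡.refl
  length-monomial c (suc n) = ≡.cong suc (length-monomial c n)

  coeff-beyond : ∀ xs m → length xs ≤ m → coeff xs m ≡ 0#
  coeff-beyond []       m       _         = ≡.refl
  coeff-beyond (x ∷ xs) (suc m) (s≤s len≤) = coeff-beyond xs m len≤

module FreshmansDream {c ℓ} (R : CommutativeSemiring c ℓ) where
  open CommutativeSemiring R hiding (zero)
  open import Relation.Binary.Reasoning.Setoid setoid
  open import Algebra.Properties.Semiring.Mult semiring using (_×_; ×-congʳ; ×-assoc-*; ×-homo-1)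
  open import Algebra.Definitions.RawSemiring rawSemiring using (_^_)
  open import Algebra.Properties.CommutativeSemiring.Binomial R using (theorem; binomialTerm)
  open CommutativeMonoidSum +-commutativeMonoid using (sum)

  sum-last : ∀ n (g : Fin (suc n) → Carrier) → (∀ (i : Fin n) → g (Fin.inject₁ i) ≈ 0#) → sum g ≈ g (Fin.fromℕ n)
  sum-last zero    g g≈0 = +-identityʳ _
  sum-last (suc n) g g≈0 = trans (+-congʳ (g≈0 zero)) (trans (+-identityˡ _) (sum-last n (λ i → g (suc i)) (λ i → g≈0 (suc i))))

  ×-vanishes : ∀ m → m × 1# ≈ 0# → ∀ z → m × z ≈ 0#
  ×-vanishes m m·1≈0 z = begin
    m × z           ≈⟨ ×-congʳ m (*-identityˡ z) ⟨
    m × (1# * z)    ≈⟨ ×-assoc-* m 1# z ⟨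
    (m × 1#) * z    ≈⟨ *-congʳ m·1≈0 ⟩
    0# * z          ≈⟨ zeroˡ z ⟩
    0#              ∎

  freshmansDream : ∀ n → .{{NonZero n}} → (∀ j → 0 < j → j < n → (n C j) × 1# ≈ 0#) →
                   ∀ x y → (x + y) ^ n ≈ x ^ n + y ^ n
  freshmansDream (suc m) vanish x y = begin
    (x + y) ^ n                            ≈⟨ theorem n x y ⟩
    t zero + sum (λ i → t (suc i))         ≈⟨ +-cong first (sum-last m (λ i → t (suc i)) middle) ⟩
    y ^ n + t (suc (Fin.fromℕ m))          ≈⟨ +-congˡ last ⟩
    y ^ n + x ^ n                          ≈⟨ +-comm _ _ ⟩
    x ^ n + y ^ n                          ∎
    where
    n = suc m
    t = binomialTerm x y n
    first : t zero ≈ y ^ n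
    first = trans (×-homo-1 _) (*-identityˡ _)
    middle : ∀ (i : Fin m) → t (suc (Fin.inject₁ i)) ≈ 0#
    middle i = ×-vanishes (n C suc (toℕ (Fin.inject₁ i))) (vanish (suc (toℕ (Fin.inject₁ i))) (s≤s z≤n)
                 (s≤s (≡.subst (_< m) (≡.sym (FinP.toℕ-inject₁ i)) (FinP.toℕ<n i)))) _
    last : t (suc (Fin.fromℕ m)) ≈ x ^ n
    last = begin
      (n C toℕ (Fin.fromℕ n)) × (x ^ toℕ (Fin.fromℕ n) * y ^ (n ∸ toℕ (Fin.fromℕ n)))
        ≈⟨ reflexive (≡.cong (λ j → (n C j) × (x ^ j * y ^ (n ∸ j))) (FinP.toℕ-fromℕ n)) ⟩
      (n C n) × (x ^ n * y ^ (n ∸ n))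
        ≈⟨ reflexive (≡.cong₂ (λ a b → a × (x ^ n * y ^ b)) (nCn≡1 n) (ℕP.n∸n≡0 n)) ⟩
      1 × (x ^ n * 1#)   ≈⟨ ×-homo-1 _ ⟩
      x ^ n * 1#         ≈⟨ *-identityʳ _ ⟩
      x ^ n              ∎

module Frobenius {c ℓ} (F : FiniteField c ℓ) {p} (pp : Prime p) (k : ℕ) (size≡ : FiniteField.size F ≡ p ℕ.^ k) where
  open FieldBasics F
  open import Relation.Binary.Reasoning.Setoid setoid
  open FermatsLittleTheorem F using (size·1≈0)
  open PolynomialRoots F
  open FreshmansDream commutativeSemiring using (freshmansDream)
  instance
    p-nonZero : NonZero p
    p-nonZero = prime⇒nonZero pp

  ι-+ : ∀ m n → ι (m ℕ.+ n) ≈ ι m + ι n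
  ι-+ = ×-homo-+ 1#

  ι-* : ∀ m n → ι (m ℕ.* n) ≈ ι m * ι n
  ι-* = ×1-homo-*

  ι-^ : ∀ n → ι (p ℕ.^ n) ≈ ι p ^ n
  ι-^ zero    = +-identityʳ 1#
  ι-^ (suc n) = trans (ι-* p (p ℕ.^ n)) (*-congˡ (ι-^ n))

  -- (ι p)^k = ι q = 0, and F has no zero divisors
  characteristic : ι p ≈ 0#
  characteristic = ^≈0⇒≈0 k (trans (sym (ι-^ k)) (trans (reflexive (≡.cong ι (≡.sym size≡))) size·1≈0))

  ι-multiple : ∀ m → ι (m ℕ.* p) ≈ 0#
  ι-multiple m = trans (ι-* m p) (trans (*-congˡ characteristic) (zeroʳ _))

  frobenius-add : ∀ x y → (x + y) ^ p ≈ x ^ p + y ^ p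
  frobenius-add = freshmansDream p binomial≈0
    where
    binomial≈0 : ∀ j → 0 < j → j < p → ι (p C j) ≈ 0#
    binomial≈0 j 0<j j<p with prime∣binomial pp 0<j j<p
    ... | divides m pCj≡m*p = trans (reflexive (≡.cong ι pCj≡m*p)) (ι-multiple m)

  frobenius-mul : ∀ x y → (x * y) ^ p ≈ x ^ p * y ^ p
  frobenius-mul x y = ^-distrib-* x y p

  frobenius-neg : ∀ x → (- x) ^ p ≈ - (x ^ p)
  frobenius-neg x = begin
    (- x) ^ p                      ≈⟨ solve 2 (λ a b → a := (a :+ b) :- b) refl ((- x) ^ p) (x ^ p) ⟩
    ((- x) ^ p + x ^ p) - x ^ p    ≈⟨ +-congʳ (frobenius-add (- x) x) ⟨
    (- x + x) ^ p - x ^ p          ≈⟨ +-congʳ (trans (^-congˡ p (-‿inverseˡ x)) (0^ p)) ⟩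
    0# - x ^ p                     ≈⟨ +-identityˡ _ ⟩
    - (x ^ p)                      ∎

  frobenius-sub : ∀ x y → (x - y) ^ p ≈ x ^ p - y ^ p
  frobenius-sub x y = trans (frobenius-add x (- y)) (+-congˡ (frobenius-neg y))

  frobenius-ι : ∀ n → ι n ^ p ≈ ι n
  frobenius-ι zero    = 0^ p
  frobenius-ι (suc n) = trans (frobenius-add 1# (ι n)) (+-cong (1^ p) (frobenius-ι n))

  no-unit-relation : ∀ {a b} x y → ι a ≈ 0# → ι b ≈ 0# → 1 ℕ.+ y ℕ.* a ≡ x ℕ.* b → ⊥
  no-unit-relation {a} {b} x y ιa≈0 ιb≈0 1+ya≡xb = 1≉0 (begin
    1#                 ≈⟨ +-identityʳ 1# ⟨
    1# + 0#            ≈⟨ +-congˡ (trans (ι-* y a) (trans (*-congˡ ιa≈0) (zeroʳ _))) ⟨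
    ι (1 ℕ.+ y ℕ.* a)  ≈⟨ reflexive (≡.cong ι 1+ya≡xb) ⟩
    ι (x ℕ.* b)        ≈⟨ trans (ι-* x b) (trans (*-congˡ ιb≈0) (zeroʳ _)) ⟩
    0#                 ∎)

  -- 0 < m < p is coprime to p, and a Bézout relation rules out ι m = 0
  ι-nonzero : ∀ {m} → 0 < m → m < p → ¬ (ι m ≈ 0#)
  ι-nonzero {m@(suc _)} _ m<p ιm≈0 with coprime-Bézout (prime⇒coprime pp m<p)
  ... | Bézout.+- x y 1+ym≡xp = no-unit-relation x y ιm≈0 characteristic 1+ym≡xp
  ... | Bézout.-+ x y 1+xp≡ym = no-unit-relation y x characteristic ιm≈0 1+xp≡ym

  ι-∸ : ∀ {i j} → i ≤ j → ι i ≈ ι j → ι (j ∸ i) ≈ 0#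
  ι-∸ {i} {j} i≤j ιi≈ιj = begin
    ι (j ∸ i)                     ≈⟨ solve 2 (λ a b → a := (b :+ a) :- b) refl (ι (j ∸ i)) (ι i) ⟩
    (ι i + ι (j ∸ i)) - ι i       ≈⟨ +-congʳ (ι-+ i (j ∸ i)) ⟨
    ι (i ℕ.+ (j ∸ i)) - ι i       ≈⟨ +-congʳ (reflexive (≡.cong ι (ℕP.m+[n∸m]≡n i≤j))) ⟩
    ι j - ι i                     ≈⟨ +-congʳ ιi≈ιj ⟨
    ι i - ι i                     ≈⟨ -‿inverseʳ _ ⟩
    0#                            ∎

  ι-injective : ∀ {i j} → i < p → j < p → ι i ≈ ι j → i ≡ j
  ι-injective {i} {j} i<p j<p ιi≈ιj with ℕP.<-cmp i j
  ... | tri≈ _ i≡j _ = i≡j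
  ... | tri< i<j _ _ = ⊥-elim (ι-nonzero (ℕP.m<n⇒0<n∸m i<j) (ℕP.≤-<-trans (ℕP.m∸n≤m j i) j<p) (ι-∸ (ℕP.<⇒≤ i<j) ιi≈ιj))
  ... | tri> _ _ j<i = ⊥-elim (ι-nonzero (ℕP.m<n⇒0<n∸m j<i) (ℕP.≤-<-trans (ℕP.m∸n≤m i j) i<p) (ι-∸ (ℕP.<⇒≤ j<i) (sym ιi≈ιj)))

  -- the prime field 𝔽_p ⊆ F, indexed by Fin p
  ιᶠ : Fin p → Carrier
  ιᶠ i = ι (toℕ i)

  ιᶠ-injective : ∀ {i j} → ιᶠ i ≈ ιᶠ j → i ≡ j
  ιᶠ-injective {i} {j} ιᶠi≈ιᶠj = FinP.toℕ-injective (ι-injective (FinP.toℕ<n i) (FinP.toℕ<n j) ιᶠi≈ιᶠj)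

  frobenius-ιᶠ : ∀ i → ιᶠ i ^ p ≈ ιᶠ i
  frobenius-ιᶠ i = frobenius-ι (toℕ i)

  -- X^p - X has the p distinct roots ιᶠ i and at most p roots, so every
  -- fixed point of the Frobenius lies in the prime field.
  frobenius-fixed : ∀ z → z ^ p ≈ z → ∃ λ (i : Fin p) → z ≈ ιᶠ i
  frobenius-fixed z zᵖ≈z with FinP.any? (λ i → z ≟ ιᶠ i)
  ... | yes found = found
  ... | no  none  = ⊥-elim (1≉0 (begin
    1#                                                    ≈⟨ +-identityʳ 1# ⟨
    1# + 0#                                               ≈⟨ +-cong (reflexive (≡.sym (coeff-monomial 1# p)))
                                                                    (reflexive (≡.sym (coeff-beyond (monomial (- 1#) 1) p (prime>1 pp)))) ⟩
    coeff (monomial 1# p) p + coeff (monomial (- 1#) 1) p ≈⟨ coeff-add (monomial 1# p) (monomial (- 1#) 1) p ⟨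
    coeff Xᵖ-X p                                          ≈⟨ Xᵖ-X≈0 p ⟩
    0#                                                    ∎))
    where
    Xᵖ-X : Poly
    Xᵖ-X = add (monomial 1# p) (monomial (- 1#) 1)
    eval-Xᵖ-X : ∀ x → eval Xᵖ-X x ≈ x ^ p - x
    eval-Xᵖ-X x = begin
      eval Xᵖ-X x                                                   ≈⟨ eval-add (monomial 1# p) (monomial (- 1#) 1) x ⟩
      eval (monomial 1# p) x + eval (monomial (- 1#) 1) x           ≈⟨ +-cong (eval-monomial 1# p x) (eval-monomial (- 1#) 1 x) ⟩
      1# * x ^ p + (- 1#) * (x * 1#)                                ≈⟨ +-cong (*-identityˡ _) (trans (-1*x≈-x _) (-‿cong (*-identityʳ x))) ⟩
      x ^ p - x                                                     ∎
    -- z together with the prime field gives p + 1 distinct roots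
    roots : Fin (suc p) → Carrier
    roots zero    = z
    roots (suc i) = ιᶠ i
    roots-injective : ∀ {i j} → roots i ≈ roots j → i ≡ j
    roots-injective {zero}  {zero}  _   = ≡.refl
    roots-injective {zero}  {suc j} z≈  = ⊥-elim (none (j , z≈))
    roots-injective {suc i} {zero}  ≈z  = ⊥-elim (none (i , sym ≈z))
    roots-injective {suc i} {suc j} eq  = ≡.cong suc (ιᶠ-injective eq)
    are-roots : ∀ i → eval Xᵖ-X (roots i) ≈ 0#
    are-roots zero    = trans (eval-Xᵖ-X z) (trans (+-congʳ zᵖ≈z) (-‿inverseʳ z))
    are-roots (suc i) = trans (eval-Xᵖ-X (ιᶠ i)) (trans (+-congʳ (frobenius-ιᶠ i)) (-‿inverseʳ _))
    length≤ : length Xᵖ-X ≤ suc p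
    length≤ = length-add (monomial 1# p) (monomial (- 1#) 1) (suc p)
                (ℕP.≤-reflexive (length-monomial 1# p)) (s≤s (ℕP.<⇒≤ (prime>1 pp)))
    Xᵖ-X≈0 : IsZero Xᵖ-X
    Xᵖ-X≈0 = root-bound (suc p) roots roots-injective Xᵖ-X length≤ are-roots

-- Since M is additive and M^k = id, the "trace"
-- T(x) = x + M(x) + ... + M^(k-1)(x) satisfies M(T x) = T x; and T is a
-- nonzero polynomial of degree p^(k-1) < q, so it cannot vanish on all of F.
module Hilbert90 {c ℓ} (F : FiniteField c ℓ) {p} (pp : Prime p) (k : ℕ) (size≡ : FiniteField.size F ≡ p ℕ.^ k)
                 (a : FiniteField.Carrier F) (a≉0 : ¬ FiniteField._≈_ F a (FiniteField.0# F))
                 (Nm[a]≈1 : FiniteField._≈_ F (Nm F p k a) (FiniteField.1# F)) where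
  open FieldBasics F
  open import Relation.Binary.Reasoning.Setoid setoid
  open FermatsLittleTheorem F using (fermat)
  open PolynomialRoots F
  open Frobenius F pp k size≡

  M : Carrier → Carrier
  M x = a * x ^ p

  M-add : ∀ x y → M (x + y) ≈ M x + M y
  M-add x y = trans (*-congˡ (frobenius-add x y)) (distribˡ a _ _)

  M-0 : M 0# ≈ 0#
  M-0 = trans (*-congˡ (0^ p)) (zeroʳ a)

  M^ : ℕ → Carrier → Carrier
  M^ zero    x = x
  M^ (suc j) x = M (M^ j x)

  M^-formula : ∀ j x → M^ j x ≈ a ^ normExp p j * x ^ (p ℕ.^ j)
  M^-formula zero    x = sym (trans (*-identityˡ _) (*-identityʳ x))
  M^-formula (suc j) x = begin
    a * (M^ j x) ^ p                            ≈⟨ *-congˡ (^-congˡ p (M^-formula j x)) ⟩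
    a * (a ^ N * x ^ P) ^ p                     ≈⟨ *-congˡ (frobenius-mul _ _) ⟩
    a * ((a ^ N) ^ p * (x ^ P) ^ p)             ≈⟨ *-congˡ (*-cong (^-assocʳ a N p) (^-assocʳ x P p)) ⟩
    a * (a ^ (N ℕ.* p) * x ^ (P ℕ.* p))         ≈⟨ *-assoc _ _ _ ⟨
    a ^ suc (N ℕ.* p) * x ^ (P ℕ.* p)           ≈⟨ reflexive (≡.cong₂ (λ m n → a ^ m * x ^ n) (normExp-suc p j) (ℕP.*-comm P p)) ⟩
    a ^ normExp p (suc j) * x ^ (p ℕ.^ suc j)   ∎
    where
    N = normExp p j
    P = p ℕ.^ j

  -- M^k = id, by Nm(a) = 1 and Fermat's little theorem
  M^k : ∀ x → M^ k x ≈ x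
  M^k x = begin
    M^ k x                          ≈⟨ M^-formula k x ⟩
    a ^ normExp p k * x ^ (p ℕ.^ k) ≈⟨ *-cong Nm[a]≈1 (reflexive (≡.cong (x ^_) (≡.sym size≡))) ⟩
    1# * x ^ q                      ≈⟨ *-identityˡ _ ⟩
    x ^ q                           ≈⟨ fermat x ⟩
    x                               ∎

  T : ℕ → Carrier → Carrier
  T zero    x = 0#
  T (suc j) x = T j x + M^ j x

  M∘T : ∀ j x → M (T j x) + x ≈ T j x + M^ j x
  M∘T zero    x = +-congʳ M-0
  M∘T (suc j) x = begin
    M (T j x + M^ j x) + x             ≈⟨ +-congʳ (M-add _ _) ⟩
    (M (T j x) + M (M^ j x)) + x       ≈⟨ solve 3 (λ a b c → (a :+ b) :+ c := (a :+ c) :+ b) refl (M (T j x)) (M (M^ j x)) x ⟩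
    (M (T j x) + x) + M (M^ j x)       ≈⟨ +-congʳ (M∘T j x) ⟩
    (T j x + M^ j x) + M^ (suc j) x    ∎

  M-fixes-T : ∀ x → M (T k x) ≈ T k x
  M-fixes-T x = begin
    M (T k x)                 ≈⟨ solve 2 (λ a b → a := (a :+ b) :- b) refl _ x ⟩
    (M (T k x) + x) - x       ≈⟨ +-congʳ (M∘T k x) ⟩
    (T k x + M^ k x) - x      ≈⟨ +-congʳ (+-congˡ (M^k x)) ⟩
    (T k x + x) - x           ≈⟨ solve 2 (λ a b → (a :+ b) :- b := a) refl _ x ⟩
    T k x                     ∎

  T-poly : ℕ → Poly
  T-poly zero    = []
  T-poly (suc j) = add (T-poly j) (monomial (a ^ normExp p j) (p ℕ.^ j))

  eval-T-poly : ∀ j x → eval (T-poly j) x ≈ T j x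
  eval-T-poly zero    x = refl
  eval-T-poly (suc j) x = begin
    eval (add (T-poly j) (monomial (a ^ normExp p j) (p ℕ.^ j))) x          ≈⟨ eval-add (T-poly j) _ x ⟩
    eval (T-poly j) x + eval (monomial (a ^ normExp p j) (p ℕ.^ j)) x       ≈⟨ +-cong (eval-T-poly j x) (trans (eval-monomial _ (p ℕ.^ j) x) (sym (M^-formula j x))) ⟩
    T j x + M^ j x                                                          ∎

  length-T-poly : ∀ j → length (T-poly j) ≤ p ℕ.^ j
  length-T-poly zero    = z≤n
  length-T-poly (suc j) = length-add (T-poly j) _ (p ℕ.^ suc j)
    (ℕP.≤-trans (length-T-poly j) (ℕP.<⇒≤ pʲ<pʲ⁺¹))
    (≡.subst (_≤ p ℕ.^ suc j) (≡.sym (length-monomial _ (p ℕ.^ j))) pʲ<pʲ⁺¹)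
    where
    pʲ<pʲ⁺¹ : p ℕ.^ j < p ℕ.^ suc j
    pʲ<pʲ⁺¹ = ℕP.^-monoʳ-< p (prime>1 pp) (ℕP.n<1+n j)

  leading-coeff : ∀ j → coeff (T-poly (suc j)) (p ℕ.^ j) ≈ a ^ normExp p j
  leading-coeff j = begin
    coeff (T-poly (suc j)) (p ℕ.^ j)                                                  ≈⟨ coeff-add (T-poly j) _ (p ℕ.^ j) ⟩
    coeff (T-poly j) (p ℕ.^ j) + coeff (monomial (a ^ normExp p j) (p ℕ.^ j)) (p ℕ.^ j) ≈⟨ +-cong (reflexive (coeff-beyond (T-poly j) _ (length-T-poly j)))
                                                                                                  (reflexive (coeff-monomial _ (p ℕ.^ j))) ⟩
    0# + a ^ normExp p j                                                              ≈⟨ +-identityˡ _ ⟩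
    a ^ normExp p j                                                                   ∎

  -- If T k vanished on all of F, the polynomial T-poly k (of length at most
  -- p^k = q) would have q roots and hence be zero, contradicting its nonzero
  -- leading coefficient.
  hilbert90 : 1 ≤ k → ∃ λ y → ¬ (y ≈ 0#) ∧ a * y ^ p ≈ y
  hilbert90 (s≤s {n = j} _) with FinP.any? (λ i → ¬? (T k (elem i) ≟ 0#))
  ... | yes (i , Tx≉0) = T k (elem i) , Tx≉0 , M-fixes-T (elem i)
  ... | no  T≈0        = ⊥-elim (^-nonzero (normExp p j) a≉0 (trans (sym (leading-coeff j)) (T-poly≈0 (p ℕ.^ j))))
    where
    T-poly≈0 : IsZero (T-poly (suc j))
    T-poly≈0 = root-bound q elem elem-injective (T-poly k) (≡.subst (length (T-poly k) ≤_) (≡.sym size≡) (length-T-poly k))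
      (λ i → trans (eval-T-poly k (elem i)) (decidable-stable (T k (elem i) ≟ 0#) (λ Tx≉0 → T≈0 (i , Tx≉0))))

-- It is additive with kernel 𝔽_p, so
-- its fibres over the image have exactly p elements.  Counting then shows
-- that the image is a proper subset of F, and that for γ′ outside the image
-- the p translates im ℘ + i γ′ (i ∈ 𝔽_p) are disjoint and cover F.
module ArtinSchreier {c ℓ} (F : FiniteField c ℓ) {p} (pp : Prime p) (k : ℕ) (size≡ : FiniteField.size F ≡ p ℕ.^ k) where
  open FieldBasics F
  open import Relation.Binary.Reasoning.Setoid setoid
  open Frobenius F pp k size≡

  ℘ : Carrier → Carrier
  ℘ x = x ^ p - x

  ℘-cong : ∀ {x y} → x ≈ y → ℘ x ≈ ℘ y
  ℘-cong x≈y = +-cong (^-congˡ p x≈y) (-‿cong x≈y)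

  ℘-add : ∀ x y → ℘ (x + y) ≈ ℘ x + ℘ y
  ℘-add x y = trans (+-congʳ (frobenius-add x y))
    (solve 4 (λ X Y x y → (X :+ Y) :- (x :+ y) := (X :- x) :+ (Y :- y)) refl (x ^ p) (y ^ p) x y)

  ℘-sub : ∀ x y → ℘ (x - y) ≈ ℘ x - ℘ y
  ℘-sub x y = trans (+-congʳ (frobenius-sub x y))
    (solve 4 (λ X Y x y → (X :- Y) :- (x :- y) := (X :- x) :- (Y :- y)) refl (x ^ p) (y ^ p) x y)

  ℘-ιᶠ : ∀ i → ℘ (ιᶠ i) ≈ 0#
  ℘-ιᶠ i = trans (+-congʳ (frobenius-ιᶠ i)) (-‿inverseʳ _)

  ker-℘ : ∀ u → ℘ u ≈ 0# → ∃ λ (i : Fin p) → u ≈ ιᶠ i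
  ker-℘ u ℘u≈0 = frobenius-fixed u (begin
    u ^ p             ≈⟨ solve 2 (λ U u → U := (U :- u) :+ u) refl (u ^ p) u ⟩
    (u ^ p - u) + u   ≈⟨ +-congʳ ℘u≈0 ⟩
    0# + u            ≈⟨ +-identityˡ u ⟩
    u                 ∎)

  Image : Carrier → Set (c ⊔ ℓ)
  Image y = ∃ λ d → ℘ d ≈ y

  image-resp : ∀ {u v} → u ≈ v → Image u → Image v
  image-resp u≈v (d , ℘d≈u) = d , trans ℘d≈u u≈v

  image? : ∀ y → Dec (Image y)
  image? y = exists? (λ d → ℘ d ≈ y) (λ d≈d′ ℘d≈y → trans (℘-cong (sym d≈d′)) ℘d≈y) (λ d → ℘ d ≟ y)

  image-sub : ∀ {u v} → Image u → Image v → Image (u - v)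
  image-sub (d , ℘d≈u) (e , ℘e≈v) = d - e , trans (℘-sub d e) (+-cong ℘d≈u (-‿cong ℘e≈v))

  image-scale : ∀ {t u} → t ^ p ≈ t → Image u → Image (t * u)
  image-scale {t} {u} tᵖ≈t (d , ℘d≈u) = t * d , (begin
    (t * d) ^ p - t * d     ≈⟨ +-congʳ (frobenius-mul t d) ⟩
    t ^ p * d ^ p - t * d   ≈⟨ +-congʳ (*-congʳ tᵖ≈t) ⟩
    t * d ^ p - t * d       ≈⟨ solve 3 (λ t D d → t :* D :- t :* d := t :* (D :- d)) refl t (d ^ p) d ⟩
    t * ℘ d                 ≈⟨ *-congˡ ℘d≈u ⟩
    t * u                   ∎)

  frobenius-inverse : ∀ {t} (t≉0 : ¬ (t ≈ 0#)) → t ^ p ≈ t → (t ⁻¹⟨ t≉0 ⟩) ^ p ≈ t ⁻¹⟨ t≉0 ⟩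
  frobenius-inverse {t} t≉0 tᵖ≈t = *-cancelˡ t t≉0 (begin
    t * t⁻¹ ^ p       ≈⟨ *-congʳ tᵖ≈t ⟨
    t ^ p * t⁻¹ ^ p   ≈⟨ frobenius-mul t t⁻¹ ⟨
    (t * t⁻¹) ^ p     ≈⟨ ^-congˡ p (inverseʳ t t≉0) ⟩
    1# ^ p            ≈⟨ 1^ p ⟩
    1#                ≈⟨ inverseʳ t t≉0 ⟨
    t * t⁻¹           ∎)
    where t⁻¹ = t ⁻¹⟨ t≉0 ⟩

  -- for γ′ ∉ im ℘ the translates im ℘ + i γ′ (i ∈ 𝔽_p) are pairwise disjoint:
  -- otherwise (ιᶠ j - ιᶠ i) γ′ ∈ im ℘, and dividing by ιᶠ j - ιᶠ i ∈ 𝔽_p gives γ′ ∈ im ℘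
  translates-disjoint : ∀ w γ′ → ¬ Image γ′ → ∀ (i j : Fin p) → Image (w - ιᶠ i * γ′) → Image (w - ιᶠ j * γ′) → i ≡ j
  translates-disjoint w γ′ γ′∉ i j in-i in-j with i FinP.≟ j
  ... | yes i≡j = i≡j
  ... | no  i≢j = ⊥-elim (γ′∉ (image-resp (cancel-inverseˡ δ δ≉0 γ′)
                    (image-scale (frobenius-inverse δ≉0 δᵖ≈δ) (image-resp difference (image-sub in-i in-j)))))
    where
    δ = ιᶠ j - ιᶠ i
    δ≉0 : ¬ (δ ≈ 0#)
    δ≉0 δ≈0 = i≢j (≡.sym (ιᶠ-injective (begin
      ιᶠ j                  ≈⟨ solve 2 (λ a b → a := (a :- b) :+ b) refl (ιᶠ j) (ιᶠ i) ⟩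
      (ιᶠ j - ιᶠ i) + ιᶠ i  ≈⟨ +-congʳ δ≈0 ⟩
      0# + ιᶠ i             ≈⟨ +-identityˡ _ ⟩
      ιᶠ i                  ∎)))
    δᵖ≈δ : δ ^ p ≈ δ
    δᵖ≈δ = trans (frobenius-sub _ _) (+-cong (frobenius-ιᶠ j) (-‿cong (frobenius-ιᶠ i)))
    difference : (w - ιᶠ i * γ′) - (w - ιᶠ j * γ′) ≈ δ * γ′
    difference = solve 4 (λ w a b g → (w :- a :* g) :- (w :- b :* g) := (b :- a) :* g) refl w (ιᶠ i) (ιᶠ j) γ′

module ArtinSchreierCounting {c ℓ} (F : FiniteField c ℓ) {p} (pp : Prime p) (k : ℕ) (size≡ : FiniteField.size F ≡ p ℕ.^ k) where
  open FieldBasics F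
  open Frobenius F pp k size≡ using (ιᶠ; ιᶠ-injective)
  open ArtinSchreier F pp k size≡
  open ≡.≡-Reasoning

  fibre : Carrier → ℕ
  fibre z = count (λ i → ℘ (elem i) ≟ z)

  fibre-outside : ∀ z → ¬ Image z → fibre z ≡ 0
  fibre-outside z z∉ = count-none (λ i → ℘ (elem i) ≟ z) (λ i ℘x≈z → z∉ (elem i , ℘x≈z))

  -- if ℘ d = z, the solutions of ℘ x = z are the x = d + ιᶠ i, i ∈ 𝔽_p
  fibre-inside : ∀ z → Image z → fibre z ≡ p
  fibre-inside z (d , ℘d≈z) = begin
    fibre z                                              ≡⟨ ∑-cong as-double-sum ⟩
    ∑ (λ x → ∑ (λ i → indicator (elem x ≟ d + ιᶠ i)))    ≡⟨ ∑-comm (λ x i → indicator (elem x ≟ d + ιᶠ i)) ⟩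
    ∑ (λ i → ∑ (λ x → indicator (elem x ≟ d + ιᶠ i)))    ≡⟨ ∑-cong (λ i → count-one-solution (_≟ d + ιᶠ i) (λ x≈y x≈ → trans (sym x≈y) x≈) (λ x≈ y≈ → trans x≈ (sym y≈)) refl) ⟩
    ∑ {p} (λ _ → 1)                                      ≡⟨ ∑-const p 1 ⟩
    p ℕ.* 1                                              ≡⟨ ℕP.*-identityʳ p ⟩
    p                                                    ∎
    where
    as-double-sum : ∀ x → indicator (℘ (elem x) ≟ z) ≡ count (λ i → elem x ≟ d + ιᶠ i)
    as-double-sum x with ℘ (elem x) ≟ z
    ... | yes ℘x≈z = ≡.sym (count-unique (λ i → elem x ≟ d + ιᶠ i) same-i (proj₁ x-d∈𝔽ₚ) x≈d+ιᶠi)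
      where
      same-i : ∀ i j → elem x ≈ d + ιᶠ i → elem x ≈ d + ιᶠ j → i ≡ j
      same-i i j x≈i x≈j = ιᶠ-injective (+-cancelˡ d (ιᶠ i) (ιᶠ j) (trans (sym x≈i) x≈j))
      x-d∈𝔽ₚ : ∃ λ (i : Fin p) → elem x - d ≈ ιᶠ i
      x-d∈𝔽ₚ = ker-℘ (elem x - d) (trans (℘-sub (elem x) d) (trans (+-cong ℘x≈z (-‿cong ℘d≈z)) (-‿inverseʳ z)))
      x≈d+ιᶠi : elem x ≈ d + ιᶠ (proj₁ x-d∈𝔽ₚ)
      x≈d+ιᶠi = trans (solve 2 (λ x d → x := d :+ (x :- d)) refl (elem x) d) (+-congˡ (proj₂ x-d∈𝔽ₚ))
    ... | no ℘x≉z = ≡.sym (count-none (λ i → elem x ≟ d + ιᶠ i)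
                      (λ i x≈ → ℘x≉z (trans (℘-cong x≈) (trans (℘-add d (ιᶠ i)) (trans (+-cong ℘d≈z (℘-ιᶠ i)) (+-identityʳ z))))))

  fibre-size : ∀ w → fibre w ≡ p ℕ.* indicator (image? w)
  fibre-size w with image? w
  ... | yes w∈ = ≡.trans (fibre-inside w w∈) (≡.sym (ℕP.*-identityʳ p))
  ... | no  w∉ = ≡.trans (fibre-outside w w∉) (≡.sym (ℕP.*-zeroʳ p))

  -- every x lies in exactly one fibre, so the fibres (over all of F, shifted by c) add up to q
  fibres-total : ∀ c → ∑ (λ y → fibre (elem y - c)) ≡ q
  fibres-total c = begin
    ∑ (λ y → ∑ (λ x → indicator (℘ (elem x) ≟ elem y - c)))   ≡⟨ ∑-comm (λ y x → indicator (℘ (elem x) ≟ elem y - c)) ⟩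
    ∑ (λ x → ∑ (λ y → indicator (℘ (elem x) ≟ elem y - c)))   ≡⟨ ∑-cong (λ x → count-one-solution (λ y → ℘ (elem x) ≟ y - c)
                                                                     (λ y≈y′ ℘x≈ → trans ℘x≈ (+-congʳ y≈y′)) (λ ℘x≈y ℘x≈y′ → +-cancelʳ _ _ _ (trans (sym ℘x≈y) ℘x≈y′))
                                                                     (solve 2 (λ a c → a := (a :+ c) :- c) refl (℘ (elem x)) c)) ⟩
    ∑ {q} (λ _ → 1)                                          ≡⟨ ∑-const q 1 ⟩
    q ℕ.* 1                                                  ≡⟨ ℕP.*-identityʳ q ⟩
    q                                                        ∎

  -- With
  -- s(y) = #{i | y - i γ′ ∈ im ℘} ≤ 1 (disjointness), the numbers
  -- T(y) = ∑_i fibre(y - i γ′) = p · s(y) are at most p and add up to p · q,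
  -- so all of them equal p and in particular s(γ) = 1.
  translates-cover : ∀ γ γ′ → ¬ Image γ′ → ∃ λ (i : Fin p) → Image (γ - ιᶠ i * γ′)
  translates-cover γ γ′ γ′∉ = proj₁ found , image-resp (+-congʳ (elem-index γ)) (proj₂ found)
    where
    s : Fin q → ℕ
    s y = count (λ i → image? (elem y - ιᶠ i * γ′))
    T : Fin q → ℕ
    T y = ∑ (λ (i : Fin p) → fibre (elem y - ιᶠ i * γ′))
    T≡p*s : ∀ y → T y ≡ p ℕ.* s y
    T≡p*s y = begin
      ∑ (λ (i : Fin p) → fibre (elem y - ιᶠ i * γ′))            ≡⟨ ∑-cong (λ i → fibre-size (elem y - ιᶠ i * γ′)) ⟩
      ∑ (λ i → p ℕ.* indicator (image? (elem y - ιᶠ i * γ′)))   ≡⟨ *-distribˡ-sum p (λ i → indicator (image? (elem y - ιᶠ i * γ′))) ⟨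
      p ℕ.* s y                                                  ∎
    T≤p : ∀ y → T y ≤ p
    T≤p y = ℕP.≤-trans (ℕP.≤-reflexive (T≡p*s y))
              (ℕP.≤-trans (ℕP.*-monoʳ-≤ p (count-≤1 _ (translates-disjoint (elem y) γ′ γ′∉))) (ℕP.≤-reflexive (ℕP.*-identityʳ p)))
    ∑T : ∑ T ≡ q ℕ.* p
    ∑T = begin
      ∑ (λ y → ∑ (λ i → fibre (elem y - ιᶠ i * γ′)))   ≡⟨ ∑-comm (λ y i → fibre (elem y - ιᶠ i * γ′)) ⟩
      ∑ (λ i → ∑ (λ y → fibre (elem y - ιᶠ i * γ′)))   ≡⟨ ∑-cong (λ i → fibres-total (ιᶠ i * γ′)) ⟩
      ∑ {p} (λ _ → q)                                  ≡⟨ ∑-const p q ⟩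
      p ℕ.* q                                          ≡⟨ ℕP.*-comm p q ⟩
      q ℕ.* p                                          ∎
    s[γ]>0 : 0 < s (index γ)
    s[γ]>0 with s (index γ) in s≡ | ∑-saturated q p T T≤p ∑T (index γ)
    ... | zero  | T≡p = ⊥-elim (ℕP.<⇒≢ (ℕP.<-trans (s≤s z≤n) (prime>1 pp))
                          (≡.sym (≡.trans (≡.sym T≡p) (≡.trans (T≡p*s (index γ)) (≡.trans (≡.cong (p ℕ.*_) s≡) (ℕP.*-zeroʳ p))))))
    ... | suc _ | _   = s≤s z≤n
    found : ∃ λ (i : Fin p) → Image (elem (index γ) - ιᶠ i * γ′)
    found = count-pos (λ i → image? (elem (index γ) - ιᶠ i * γ′)) s[γ]>0

  -- ℘ is not onto: otherwise every fibre has p elements and q = ∑ fibres = q · p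
  image-proper : ∃ λ γ → ¬ Image γ
  image-proper with FinP.any? (λ y → ¬? (image? (elem y)))
  ... | yes (y , y∉) = elem y , y∉
  ... | no  all-in   = ⊥-elim (ℕP.<⇒≢ (prime>1 pp) (≡.sym p≡1))
    where
    in-image : ∀ y → Image (elem y - 0#)
    in-image y = image-resp (sym (trans (+-congˡ -0#≈0#) (+-identityʳ _)))
                   (decidable-stable (image? (elem y)) (λ y∉ → all-in (y , y∉)))
    q*p≡q*1 : q ℕ.* p ≡ q ℕ.* 1
    q*p≡q*1 = begin
      q ℕ.* p                      ≡⟨ ∑-const q p ⟨
      ∑ {q} (λ _ → p)              ≡⟨ ∑-cong (λ y → fibre-inside _ (in-image y)) ⟨
      ∑ (λ y → fibre (elem y - 0#)) ≡⟨ fibres-total 0# ⟩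
      q                            ≡⟨ ℕP.*-identityʳ q ⟨
      q ℕ.* 1                      ∎
    p≡1 : p ≡ 1
    p≡1 with size-suc
    ... | n , q≡1+n = ℕP.*-cancelˡ-≡ p 1 (suc n) (≡.subst (λ m → m ℕ.* p ≡ m ℕ.* 1) q≡1+n q*p≡q*1)

module _ {a₁ ℓ₁ a₂ ℓ₂} {S : Setoid a₁ ℓ₁} {T : Setoid a₂ ℓ₂} where
  private
    module S = Setoid S
    module T = Setoid T

  DynEquiv-sym : ∀ {f g} → (∀ {x y} → x T.≈ y → g x T.≈ g y) → DynEquiv S T f g → DynEquiv T S g f
  DynEquiv-sym {f} {g} g-cong (σ , σ⁻¹gσ≈f) = Symmetry.inverse σ , σfσ⁻¹≈g
    where
    open Inverse σ
    open import Relation.Binary.Reasoning.Setoid T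
    σfσ⁻¹≈g : ∀ y → to (f (from y)) T.≈ g y
    σfσ⁻¹≈g y = begin
      to (f (from y))                     ≈⟨ to-cong (σ⁻¹gσ≈f (from y)) ⟨
      to (from (g (to (from y))))         ≈⟨ strictlyInverseˡ _ ⟩
      g (to (from y))                     ≈⟨ g-cong (strictlyInverseˡ y) ⟩
      g y                                 ∎

  DynEquiv-fixedPoint : ∀ {f g} → (∀ {x y} → x T.≈ y → g x T.≈ g y) → DynEquiv S T f g →
                        HasFixedPoint S f ⇔ HasFixedPoint T g
  DynEquiv-fixedPoint {f} {g} g-cong (σ , σ⁻¹gσ≈f) = mk⇔
    (λ (x , fx≈x) → to x , T.trans (T.sym (strictlyInverseˡ _)) (to-cong (S.trans (σ⁻¹gσ≈f x) fx≈x)))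
    (λ (y , gy≈y) → from y , S.trans (S.sym (σ⁻¹gσ≈f (from y))) (from-cong (T.trans (g-cong (strictlyInverseˡ y)) gy≈y)))
    where open Inverse σ

module _ {a₁ ℓ₁ a₂ ℓ₂ a₃ ℓ₃} {S : Setoid a₁ ℓ₁} {T : Setoid a₂ ℓ₂} {U : Setoid a₃ ℓ₃} where
  DynEquiv-trans : ∀ {f g h} → DynEquiv S T f g → DynEquiv T U g h → DynEquiv S U f h
  DynEquiv-trans (σ , σ⁻¹gσ≈f) (τ , τ⁻¹hτ≈g) = Composition.inverse σ τ ,
    λ x → Setoid.trans S (Inverse.from-cong σ (τ⁻¹hτ≈g (Inverse.to σ x))) (σ⁻¹gσ≈f x)

module AffineFrobenius {c ℓ} (F : FiniteField c ℓ) {p} (pp : Prime p) (k : ℕ) (1≤k : 1 ≤ k)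
                       (size≡ : FiniteField.size F ≡ p ℕ.^ k) where
  open FieldBasics F
  open import Relation.Binary.Reasoning.Setoid setoid
  open Frobenius F pp k size≡
  open ArtinSchreier F pp k size≡
  open ArtinSchreierCounting F pp k size≡

  f : Carrier → Carrier → Carrier → Carrier
  f = affineFrob F p

  f-cong : ∀ a b {x y} → x ≈ y → f a b x ≈ f a b y
  f-cong a b x≈y = +-congʳ (*-congˡ (^-congˡ p x≈y))

  Admissible : Carrier → Set ℓ
  Admissible a = ¬ (a ≈ 0#) ∧ Nm F p k a ≈ 1#

  twist-fixed : ∀ {a} → Admissible a → ∃ λ y → ¬ (y ≈ 0#) ∧ a * y ^ p ≈ y
  twist-fixed {a} (a≉0 , Nm[a]≈1) = Hilbert90.hilbert90 F pp k size≡ a a≉0 Nm[a]≈1 1≤k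

  1-admissible : Admissible 1#
  1-admissible = 1≉0 , 1^ (normExp p k)

  hasFixedPoint? : ∀ a b → Dec (HasFixedPoint setoid (f a b))
  hasFixedPoint? a b = exists? (λ x → f a b x ≈ x) (λ x≈y fx≈x → trans (f-cong a b (sym x≈y)) (trans fx≈x x≈y)) (λ x → f a b x ≟ x)

  Equiv : (Carrier → Carrier) → (Carrier → Carrier) → Set (c ⊔ ℓ)
  Equiv = DynEquiv setoid setoid

  affine : ∀ u d → ¬ (u ≈ 0#) → Inverse setoid setoid
  affine u d u≉0 = record
    { to        = λ x → u * x + d
    ; from      = λ y → u⁻¹ * (y - d)
    ; to-cong   = λ x≈y → +-congʳ (*-congˡ x≈y)
    ; from-cong = λ x≈y → *-congˡ (+-congʳ x≈y)
    ; inverse   = (λ {y} {x} x≈ → begin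
                     u * x + d                  ≈⟨ +-congʳ (*-congˡ x≈) ⟩
                     u * (u⁻¹ * (y - d)) + d    ≈⟨ +-congʳ (cancel-inverseʳ u u≉0 _) ⟩
                     (y - d) + d                ≈⟨ solve 2 (λ y d → (y :- d) :+ d := y) refl y d ⟩
                     y                          ∎)
                , (λ {x} {y} y≈ → begin
                     u⁻¹ * (y - d)              ≈⟨ *-congˡ (+-congʳ y≈) ⟩
                     u⁻¹ * ((u * x + d) - d)    ≈⟨ *-congˡ (solve 2 (λ a d → (a :+ d) :- d := a) refl (u * x) d) ⟩
                     u⁻¹ * (u * x)              ≈⟨ cancel-inverseˡ u u≉0 x ⟩
                     x                          ∎)
    }
    where u⁻¹ = u ⁻¹⟨ u≉0 ⟩

  affine-equivalence : ∀ g h u d (u≉0 : ¬ (u ≈ 0#)) → (∀ x → h (u * x + d) ≈ u * g x + d) → Equiv g h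
  affine-equivalence g h u d u≉0 intertwines = affine u d u≉0 , λ x → begin
    u⁻¹ * (h (u * x + d) - d)      ≈⟨ *-congˡ (+-congʳ (intertwines x)) ⟩
    u⁻¹ * ((u * g x + d) - d)      ≈⟨ *-congˡ (solve 2 (λ a d → (a :+ d) :- d := a) refl (u * g x) d) ⟩
    u⁻¹ * (u * g x)                ≈⟨ cancel-inverseˡ u u≉0 (g x) ⟩
    g x                            ∎
    where u⁻¹ = u ⁻¹⟨ u≉0 ⟩

  N : Carrier → Carrier → Carrier
  N = f 1#

  -- with y₀ from Hilbert 90 and a fixed point x₀, x ↦ y₀ x + x₀ conjugates x^p to f
  normal-form-fixed : ∀ a b → Admissible a → HasFixedPoint setoid (f a b) → Equiv (N 0#) (f a b)
  normal-form-fixed a b adm (x₀ , fx₀≈x₀) with twist-fixed adm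
  ... | y₀ , y₀≉0 , ay₀ᵖ≈y₀ = affine-equivalence (N 0#) (f a b) y₀ x₀ y₀≉0 λ x → begin
    a * (y₀ * x + x₀) ^ p + b                    ≈⟨ +-congʳ (*-congˡ (trans (frobenius-add _ _) (+-congʳ (frobenius-mul y₀ x)))) ⟩
    a * (y₀ ^ p * x ^ p + x₀ ^ p) + b            ≈⟨ solve 5 (λ a Y X Z b → a :* (Y :* X :+ Z) :+ b := (a :* Y) :* X :+ (a :* Z :+ b)) refl a (y₀ ^ p) (x ^ p) (x₀ ^ p) b ⟩
    (a * y₀ ^ p) * x ^ p + (a * x₀ ^ p + b)      ≈⟨ +-cong (*-congʳ ay₀ᵖ≈y₀) fx₀≈x₀ ⟩
    y₀ * x ^ p + x₀                              ≈⟨ +-congʳ (*-congˡ (sym (trans (+-identityʳ _) (*-identityˡ _)))) ⟩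
    y₀ * (1# * x ^ p + 0#) + x₀                  ∎

  normal-form : ∀ a b → Admissible a → ∃ λ β → Equiv (N β) (f a b)
  normal-form a b adm with twist-fixed adm
  ... | y₀ , y₀≉0 , ay₀ᵖ≈y₀ = β , affine-equivalence (N β) (f a b) y₀ 0# y₀≉0 λ x → begin
    a * (y₀ * x + 0#) ^ p + b            ≈⟨ +-congʳ (*-congˡ (trans (^-congˡ p (+-identityʳ _)) (frobenius-mul y₀ x))) ⟩
    a * (y₀ ^ p * x ^ p) + b             ≈⟨ +-congʳ (*-assoc _ _ _) ⟨
    (a * y₀ ^ p) * x ^ p + b             ≈⟨ +-cong (*-congʳ ay₀ᵖ≈y₀) (sym (cancel-inverseʳ y₀ y₀≉0 b)) ⟩
    y₀ * x ^ p + y₀ * β                  ≈⟨ distribˡ y₀ _ _ ⟨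
    y₀ * (x ^ p + β)                     ≈⟨ trans (+-identityʳ _) (*-congˡ (+-congʳ (*-identityˡ _))) ⟨
    y₀ * (1# * x ^ p + β) + 0#           ∎
    where β = y₀ ⁻¹⟨ y₀≉0 ⟩ * b

  -- a root d of ℘(d) = -β is a fixed point of x^p + β
  fixed-point-free : ∀ β → ¬ HasFixedPoint setoid (N β) → ¬ Image (- β)
  fixed-point-free β no-fixed (d , ℘d≈-β) = no-fixed (d , (begin
    1# * d ^ p + β         ≈⟨ +-congʳ (*-identityˡ _) ⟩
    d ^ p + β              ≈⟨ solve 3 (λ D d β → D :+ β := (D :- d) :+ d :+ β) refl (d ^ p) d β ⟩
    ℘ d + d + β            ≈⟨ +-congʳ (+-congʳ ℘d≈-β) ⟩
    - β + d + β            ≈⟨ solve 2 (λ β d → :- β :+ d :+ β := d) refl β d ⟩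
    d                      ∎))

  -- Two fixed-point-free normal forms are equivalent: pick i ∈ 𝔽_p and d with
  -- ℘ d = -β + ιᶠ i β′; then ιᶠ i ≠ 0 and x ↦ ιᶠ i x + d conjugates x^p + β′ to x^p + β.
  normal-forms-equivalent : ∀ β β′ → ¬ Image (- β) → ¬ Image (- β′) → Equiv (N β′) (N β)
  normal-forms-equivalent β β′ -β∉ -β′∉ with translates-cover (- β) (- β′) -β′∉
  ... | i , d , ℘d≈ = affine-equivalence (N β′) (N β) u d u≉0 λ x → begin
    1# * (u * x + d) ^ p + β                    ≈⟨ +-congʳ (trans (*-identityˡ _) (trans (frobenius-add _ _) (+-congʳ (trans (frobenius-mul u x) (*-congʳ (frobenius-ιᶠ i)))))) ⟩
    (u * x ^ p + d ^ p) + β                     ≈⟨ +-congʳ (solve 4 (λ u X D d → u :* X :+ D := u :* X :+ (D :- d) :+ d) refl u (x ^ p) (d ^ p) d) ⟩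
    (u * x ^ p + ℘ d + d) + β                   ≈⟨ +-congʳ (+-congʳ (+-congˡ ℘d≈)) ⟩
    (u * x ^ p + (- β - u * - β′) + d) + β      ≈⟨ solve 5 (λ u X β B d → u :* X :+ (:- β :- u :* (:- B)) :+ d :+ β := u :* (X :+ B) :+ d) refl u (x ^ p) β β′ d ⟩
    u * (x ^ p + β′) + d                        ≈⟨ +-congʳ (*-congˡ (+-congʳ (*-identityˡ _))) ⟨
    u * (1# * x ^ p + β′) + d                   ∎
    where
    u = ιᶠ i
    u≉0 : ¬ (u ≈ 0#)
    u≉0 u≈0 = -β∉ (d , trans ℘d≈ (trans (+-congˡ (trans (-‿cong (trans (*-congʳ u≈0) (zeroˡ _))) -0#≈0#)) (+-identityʳ _)))

  -- The fixed points of f are x₀ + ιᶠ i y₀, i ∈ 𝔽_p: their differences d satisfy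
  -- a d^p = d, so d / y₀ is fixed by the Frobenius and lies in 𝔽_p.
  fixed-points : ∀ a b → Admissible a → HasFixedPoint setoid (f a b) →
                 Bijection (≡.setoid (Fin p)) (FixedPoints setoid (f a b))
  fixed-points a b adm (x₀ , fx₀≈x₀) with twist-fixed adm
  ... | y₀ , y₀≉0 , ay₀ᵖ≈y₀ = record
    { to        = λ i → point i , point-fixed i
    ; cong      = λ { ≡.refl → refl }
    ; bijective = point-injective , point-surjective
    }
    where
    point : Fin p → Carrier
    point i = x₀ + ιᶠ i * y₀
    point-fixed : ∀ i → f a b (point i) ≈ point i
    point-fixed i = begin
      a * (x₀ + ιᶠ i * y₀) ^ p + b                  ≈⟨ +-congʳ (*-congˡ (trans (frobenius-add _ _) (+-congˡ (trans (frobenius-mul _ _) (*-congʳ (frobenius-ιᶠ i)))))) ⟩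
      a * (x₀ ^ p + ιᶠ i * y₀ ^ p) + b              ≈⟨ solve 5 (λ a X c Y b → a :* (X :+ c :* Y) :+ b := (a :* X :+ b) :+ c :* (a :* Y)) refl a (x₀ ^ p) (ιᶠ i) (y₀ ^ p) b ⟩
      (a * x₀ ^ p + b) + ιᶠ i * (a * y₀ ^ p)        ≈⟨ +-cong fx₀≈x₀ (*-congˡ ay₀ᵖ≈y₀) ⟩
      x₀ + ιᶠ i * y₀                                ∎
    point-injective : ∀ {i j} → point i ≈ point j → i ≡ j
    point-injective {i} {j} pᵢ≈pⱼ = ιᶠ-injective (*-cancelˡ y₀ y₀≉0 (begin
      y₀ * ιᶠ i       ≈⟨ solve 3 (λ y c x → y :* c := (x :+ c :* y) :- x) refl y₀ (ιᶠ i) x₀ ⟩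
      point i - x₀    ≈⟨ +-congʳ pᵢ≈pⱼ ⟩
      point j - x₀    ≈⟨ solve 3 (λ y c x → (x :+ c :* y) :- x := y :* c) refl y₀ (ιᶠ j) x₀ ⟩
      y₀ * ιᶠ j       ∎))
    point-surjective : ∀ (w : Σ Carrier (λ x → f a b x ≈ x)) → ∃ λ i → ∀ {j} → j ≡ i → point j ≈ proj₁ w
    point-surjective (x , fx≈x) = proj₁ t∈𝔽ₚ , λ { ≡.refl → point≈x }
      where
      d = x - x₀
      adᵖ≈d : a * d ^ p ≈ d
      adᵖ≈d = begin
        a * (x - x₀) ^ p                       ≈⟨ *-congˡ (frobenius-sub x x₀) ⟩
        a * (x ^ p - x₀ ^ p)                   ≈⟨ solve 4 (λ a X Z b → a :* (X :- Z) := (a :* X :+ b) :- (a :* Z :+ b)) refl a (x ^ p) (x₀ ^ p) b ⟩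
        (a * x ^ p + b) - (a * x₀ ^ p + b)     ≈⟨ +-cong fx≈x (-‿cong fx₀≈x₀) ⟩
        x - x₀                                 ∎
      t = y₀ ⁻¹⟨ y₀≉0 ⟩ * d
      y₀t≈d : y₀ * t ≈ d
      y₀t≈d = cancel-inverseʳ y₀ y₀≉0 d
      tᵖ≈t : t ^ p ≈ t
      tᵖ≈t = *-cancelˡ y₀ y₀≉0 (begin
        y₀ * t ^ p            ≈⟨ *-congʳ ay₀ᵖ≈y₀ ⟨
        (a * y₀ ^ p) * t ^ p  ≈⟨ *-assoc _ _ _ ⟩
        a * (y₀ ^ p * t ^ p)  ≈⟨ *-congˡ (frobenius-mul y₀ t) ⟨
        a * (y₀ * t) ^ p      ≈⟨ *-congˡ (^-congˡ p y₀t≈d) ⟩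
        a * d ^ p             ≈⟨ adᵖ≈d ⟩
        d                     ≈⟨ y₀t≈d ⟨
        y₀ * t                ∎)
      t∈𝔽ₚ = frobenius-fixed t tᵖ≈t
      point≈x : point (proj₁ t∈𝔽ₚ) ≈ x
      point≈x = begin
        x₀ + ιᶠ (proj₁ t∈𝔽ₚ) * y₀   ≈⟨ +-congˡ (*-congʳ (proj₂ t∈𝔽ₚ)) ⟨
        x₀ + t * y₀                ≈⟨ +-congˡ (trans (*-comm _ _) y₀t≈d) ⟩
        x₀ + (x - x₀)              ≈⟨ solve 2 (λ a b → a :+ (b :- a) := b) refl x₀ x ⟩
        x                          ∎

  with-fixed-point : ∃ λ a → ∃ λ b → Admissible a ∧ HasFixedPoint setoid (f a b)
  with-fixed-point = 1# , 0# , 1-admissible , 0# , trans (+-identityʳ _) (trans (*-identityˡ _) (0^ p))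

  -- x ↦ x^p - γ has no fixed point when γ ∉ im ℘
  without-fixed-point : ∃ λ a → ∃ λ b → Admissible a ∧ ¬ HasFixedPoint setoid (f a b)
  without-fixed-point with image-proper
  ... | γ , γ∉ = 1# , - γ , 1-admissible , λ (x , fx≈x) → γ∉ (x , (begin
    x ^ p - x                   ≈⟨ solve 3 (λ X x g → X :- x := (X :+ (:- g)) :- x :+ g) refl (x ^ p) x γ ⟩
    (x ^ p + - γ) - x + γ       ≈⟨ +-congʳ (+-congʳ (trans (+-congʳ (sym (*-identityˡ _))) fx≈x)) ⟩
    x - x + γ                   ≈⟨ solve 2 (λ x g → x :- x :+ g := g) refl x γ ⟩
    γ                           ∎))

  -- Two systems are equivalent iff both or neither have a fixed point:
  -- both are equivalent to x^p in the first case, and to fixed-point-free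
  -- normal forms, which are mutually equivalent, in the second.
  classification : ∀ a b a′ b′ → Admissible a → Admissible a′ →
                   Equiv (f a b) (f a′ b′) ⇔ (HasFixedPoint setoid (f a b) ⇔ HasFixedPoint setoid (f a′ b′))
  classification a b a′ b′ adm adm′ = mk⇔ (DynEquiv-fixedPoint (f-cong a′ b′)) same-type⇒equivalent
    where
    same-type⇒equivalent : (HasFixedPoint setoid (f a b) ⇔ HasFixedPoint setoid (f a′ b′)) → Equiv (f a b) (f a′ b′)
    same-type⇒equivalent same with hasFixedPoint? a b
    ... | yes fixed = DynEquiv-trans {f = f a b} {N 0#} {f a′ b′} (DynEquiv-sym {f = N 0#} (f-cong a b) (normal-form-fixed a b adm fixed))
                                                (normal-form-fixed a′ b′ adm′ (Equivalence.to same fixed))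
    ... | no  free with normal-form a b adm | normal-form a′ b′ adm′
    ...   | β , Nβ~f | β′ , Nβ′~f′ =
      DynEquiv-trans {f = f a b} {N β} {f a′ b′} (DynEquiv-sym {f = N β} (f-cong a b) Nβ~f)
                     (DynEquiv-trans {f = N β} {N β′} {f a′ b′} (normal-forms-equivalent β′ β -β′∉ -β∉) Nβ′~f′)
      where
      -β∉ : ¬ Image (- β)
      -β∉ = fixed-point-free β λ Nβ-fixed → free (Equivalence.to (DynEquiv-fixedPoint (f-cong a b) Nβ~f) Nβ-fixed)
      -β′∉ : ¬ Image (- β′)
      -β′∉ = fixed-point-free β′ λ Nβ′-fixed →
        free (Equivalence.from same (Equivalence.to (DynEquiv-fixedPoint (f-cong a′ b′) Nβ′~f′) Nβ′-fixed))

open import Data.Product using (_×_)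
open import Data.Nat using (_^_)

theorem3p6 : ∀ {c ℓ} (p k : ℕ) → Prime p → 1 ≤ k →
    (F : FiniteField c ℓ) → FiniteField.size F ≡ p ^ k →
    let open FiniteField F in
    let Adm : Carrier → Set ℓ
        Adm a = ¬ (a ≈ 0#) × Nm F p k a ≈ 1#
    in
    (∃ λ a → ∃ λ b → Adm a × HasFixedPoint setoid (affineFrob F p a b))
    × (∃ λ a → ∃ λ b → Adm a × ¬ HasFixedPoint setoid (affineFrob F p a b))
    × (∀ a b a′ b′ → Adm a → Adm a′ →
         DynEquiv setoid setoid (affineFrob F p a b) (affineFrob F p a′ b′)
         ⇔ (HasFixedPoint setoid (affineFrob F p a b)
             ⇔ HasFixedPoint setoid (affineFrob F p a′ b′)))
    × (∀ a b → Adm a → HasFixedPoint setoid (affineFrob F p a b) →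
         Bijection (≡.setoid (Fin p)) (FixedPoints setoid (affineFrob F p a b)))
theorem3p6 p k pp 1≤k F size≡ = with-fixed-point , without-fixed-point , classification , fixed-points
  where open AffineFrobenius F pp k 1≤k size≡
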